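{- Let $G=(V,E)$ be a finite graph, $A\subseteq V$, and $c:A\to[k]$ a partial coloring. Then $|\chi_{G,c}(-1)|$ equals the number of acyclic orientations of $G$ for which there is no directed path (of positive length) from $a$ to $b$ whenever $a,b\in A$ with $c(a)\ge c(b)$.
   Context: $[k]=\{1,\dots,k\}$. A coloring $\widehat c:V\to[m]$ extends $c$ if $\widehat c|_A=c$; it is proper if adjacent vertices receive distinct colors. $\chi_{G,c}$ is the polynomial such that for all integers $m\ge k$, $\chi_{G,c}(m)$ is the number of proper colorings $V\to[m]$ extending $c$ (the zero polynomial if none exist). An orientation of $G$ is acyclic if it contains no directed cycle. -}

module Defs where

open import Data.Nat using (ℕ; zero; suc; _≤_)
open import Data.Integer using (ℤ; +_; -_) renaming (_+_ to _+ℤ_; _*_ to _*ℤ_)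
open import Data.Fin using (Fin; toℕ)
open import Data.Vec using (Vec; lookup)
open import Data.List using (List; []; _∷_; length)
open import Data.List.Membership.Propositional using (_∈_)
open import Data.List.Relation.Unary.Unique.Propositional using (Unique)
open import Data.Maybe using (Maybe; just; nothing)
open import Data.Bool using (Bool; true; false)
open import Data.Product using (Σ; ∃; _×_; _,_; proj₁; proj₂)
open import Data.Sum using (_⊎_)
open import Data.Empty using (⊥)
open import Relation.Nullary using (¬_)
open import Relation.Binary.PropositionalEquality using (_≡_; _≢_)
open import Function.Bundles using (_⇔_)

HasCount : {X : Set} → (X → Set) → ℕ → Set
HasCount {X} P N =
  Σ (List X) λ L → Unique L × ((x : X) → (x ∈ L) ⇔ P x) × (length L ≡ N)

-- Polynomials with integer coefficients: coefficient list, constant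
-- term first.  Evaluation by Horner's rule.

Poly : Set
Poly = List ℤ

eval : Poly → ℤ → ℤ
eval []       x = + 0
eval (a ∷ as) x = a +ℤ (x *ℤ eval as x)

record Graph (n : ℕ) : Set where
  field
    e     : ℕ
    edges : Vec (Fin n × Fin n) e
    loopless : (i : Fin e) → proj₁ (lookup edges i) ≢ proj₂ (lookup edges i)
    simple   : (i j : Fin e) →
               (lookup edges i ≡ lookup edges j ⊎
                (proj₁ (lookup edges i) ≡ proj₂ (lookup edges j) ×
                 proj₂ (lookup edges i) ≡ proj₁ (lookup edges j))) → i ≡ j

open Graph public

Adjacent : {n : ℕ} → Graph n → Fin n → Fin n → Set
Adjacent G u v = Σ (Fin (e G)) λ i → lookup (edges G) i ≡ (u , v)

-- Partial colouring c : A → [k], A ⊆ V: vertices outside A map to nothing.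
-- The colour set [k] = {1..k} is represented by Fin k (order-preserving shift).
PartialColoring : ℕ → ℕ → Set
PartialColoring n k = Fin n → Maybe (Fin k)

Coloring : ℕ → ℕ → Set
Coloring n m = Vec (Fin m) n

Extends : {n k m : ℕ} → PartialColoring n k → Coloring n m → Set
Extends {n} c ĉ = (v : Fin n) (i : _) → c v ≡ just i → toℕ (lookup ĉ v) ≡ toℕ i

Proper : {n m : ℕ} → Graph n → Coloring n m → Set
Proper G ĉ = ∀ u v → Adjacent G u v → lookup ĉ u ≢ lookup ĉ v

ProperExtension : {n k : ℕ} → Graph n → PartialColoring n k → (m : ℕ) →
                  Coloring n m → Set
ProperExtension G c m ĉ = Proper G ĉ × Extends c ĉ

IsChromaticPoly : {n k : ℕ} → Graph n → PartialColoring n k → Poly → Set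
IsChromaticPoly {n} {k} G c P =
  (m : ℕ) → k ≤ m →
  Σ ℕ λ N → HasCount (ProperExtension G c m) N × eval P (+ m) ≡ + N

-- Orientations: edge i = (u , v) is oriented u → v if true, v → u if false.

Orientation : {n : ℕ} → Graph n → Set
Orientation G = Vec Bool (e G)

Arc : {n : ℕ} (G : Graph n) → Orientation G → Fin n → Fin n → Set
Arc G o u v = Σ (Fin (e G)) λ i →
  (lookup (edges G) i ≡ (u , v) × lookup o i ≡ true) ⊎
  (lookup (edges G) i ≡ (v , u) × lookup o i ≡ false)

data Path {n : ℕ} (G : Graph n) (o : Orientation G) : Fin n → Fin n → Set where
  arc  : ∀ {u v} → Arc G o u v → Path G o u v
  _∷ₚ_ : ∀ {u v w} → Arc G o u v → Path G o v w → Path G o u w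

Acyclic : {n : ℕ} (G : Graph n) → Orientation G → Set
Acyclic G o = ∀ v → ¬ Path G o v v

Compatible : {n k : ℕ} (G : Graph n) → PartialColoring n k → Orientation G → Set
Compatible G c o = ∀ a b i j → c a ≡ just i → c b ≡ just j →
  toℕ j ≤ toℕ i → ¬ Path G o a b

GoodOrientation : {n k : ℕ} (G : Graph n) → PartialColoring n k →
                  Orientation G → Set
GoodOrientation G c o = Acyclic G o × Compatible G c o

-- Colours are taken from ℕ, and the statement is proved for every precolouring d by induction
-- on the number of uncoloured vertices. Pick an uncoloured v and let k exceed all colours of d.
-- Colouring v with any i ≥ k is a relabelling of colouring it with k, so
--   χ_d(m) = Σ_{i<k} χ_{d[v≔i]}(m) + (m - k) χ_{d[v≔k]}(m).
-- On the orientation side let d[v≔↑j] colour v with j after shifting the colours ≥ j up by one.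
-- For an orientation good for d, the j ≤ k for which it is good for d[v≔↑j] form an interval, and
-- the i < k for which it is good for d[v≔i] are that interval without its right end. Each
-- d[v≔↑j] is again a relabelling of d[v≔k]; having the same chromatic polynomial, it has (by
-- induction, through the value at -1) as many good orientations. Hence
--   #good(d) + Σ_{i<k} #good(d[v≔i]) = (k + 1) #good(d[v≔k]),
-- which is the recurrence for χ_d evaluated at m = -1, up to the sign (-1)^(#uncoloured).
-- If every vertex is coloured, both χ_d and #good(d) are 1 or 0 according as the colouring is
-- proper, the only good orientation pointing every edge towards the larger colour.

module Submission where

open import Defs
open import Data.Bool using (true; false; if_then_else_)
import Data.Bool.Properties as Bool
open import Data.Empty using (⊥-elim)
open import Data.Fin as Fin using (Fin; toℕ; fromℕ<)
import Data.Fin.Properties as Fin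
open import Data.Integer as ℤ using (ℤ; +_; -_; _-_; -1ℤ; _^_; ∣_∣; -[1+_])
  renaming (_+_ to _+ℤ_; _*_ to _*ℤ_)
import Data.Integer.Properties as ℤ
open import Data.Integer.Tactic.RingSolver using (solve-∀)
open import Data.List using (List; []; _∷_; length; map; filter; allFin; cartesianProductWith)
import Data.List.Properties as List
open import Data.List.Membership.Propositional using (_∈_)
import Data.List.Membership.Propositional.Properties as ∈
open import Data.List.Membership.Propositional.Properties.WithK using (unique∧set⇒bag)
open import Data.List.Relation.Binary.BagAndSetEquality using (∼bag⇒↭)
open import Data.List.Relation.Binary.Permutation.Propositional using (_↭_)
import Data.List.Relation.Binary.Permutation.Propositional.Properties as ↭
open import Data.List.Relation.Unary.All as All using (All; []; _∷_)
open import Data.List.Relation.Unary.AllPairs as AllPairs using ([]; _∷_)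
open import Data.List.Relation.Unary.Any using (here; there)
open import Data.List.Relation.Unary.Unique.Propositional using (Unique)
import Data.List.Relation.Unary.Unique.Propositional.Properties as Unique
open import Data.Maybe as Maybe using (Maybe; just; nothing; maybe)
import Data.Maybe.Properties as Maybe
open import Data.Nat as ℕ using (ℕ; zero; suc; _+_; _*_; _∸_; _≤_; _<_; _⊔_; z≤n; s≤s)
open import Data.Nat.Induction using (<-rec)
open import Data.Nat.ListAction using (sum)
open import Data.Nat.ListAction.Properties using (sum-↭)
import Data.Nat.Properties as ℕ
open import Algebra.Properties.CommutativeSemigroup ℕ.+-commutativeSemigroup
  using () renaming (interchange to +-interchange)
import Data.Nat.Tactic.RingSolver as ℕ-Solver
open import Data.Product using (Σ; _×_; _,_; proj₁; proj₂)
import Data.Product.Properties as Product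
open import Data.Sum using (_⊎_; inj₁; inj₂)
open import Data.Vec as Vec using (Vec; lookup) renaming ([] to []ᵥ; _∷_ to _∷ᵥ_)
import Data.Vec.Properties as Vec
open import Function using (_∘_; case_of_)
open import Function.Bundles using (_⇔_; mk⇔; Equivalence)
open import Relation.Binary.Definitions using (tri<; tri≈; tri>)
open import Relation.Binary.PropositionalEquality
open import Relation.Nullary using (¬_; Dec; yes; no; does; ¬?)
open import Relation.Nullary.Decidable as Dec using (_×-dec_; _⊎-dec_)
open import Relation.Unary using (Pred; Decidable)

open Equivalence using (to; from)

-- Finite sums and counting

sumOver : {A : Set} → List A → (A → ℕ) → ℕ
sumOver xs f = sum (map f xs)

sumBelow : ℕ → (ℕ → ℕ) → ℕ
sumBelow zero    f = 0
sumBelow (suc t) f = sumBelow t f + f t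

sumOver-cong : {A : Set} {f g : A → ℕ} → (∀ x → f x ≡ g x) → ∀ xs → sumOver xs f ≡ sumOver xs g
sumOver-cong f≗g xs = cong sum (List.map-cong f≗g xs)

sumOver-+ : {A : Set} (f g : A → ℕ) → ∀ xs →
            sumOver xs (λ x → f x + g x) ≡ sumOver xs f + sumOver xs g
sumOver-+ f g []       = refl
sumOver-+ f g (x ∷ xs) = begin
  f x + g x + sumOver xs (λ x → f x + g x)   ≡⟨ cong (λ t → f x + g x + t) (sumOver-+ f g xs) ⟩
  f x + g x + (sumOver xs f + sumOver xs g)   ≡⟨ +-interchange (f x) (g x) _ _ ⟩
  f x + sumOver xs f + (g x + sumOver xs g)   ∎
  where open ≡-Reasoning

sumOver-zero : {A : Set} (xs : List A) → sumOver xs (λ _ → 0) ≡ 0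
sumOver-zero []       = refl
sumOver-zero (_ ∷ xs) = sumOver-zero xs

sumOver-sumBelow : {A : Set} (f : ℕ → A → ℕ) → ∀ t xs →
  sumOver xs (λ x → sumBelow t (λ i → f i x)) ≡ sumBelow t (λ i → sumOver xs (f i))
sumOver-sumBelow f zero    xs = sumOver-zero xs
sumOver-sumBelow f (suc t) xs = begin
  sumOver xs (λ x → sumBelow t (λ i → f i x) + f t x)
    ≡⟨ sumOver-+ (λ x → sumBelow t (λ i → f i x)) (f t) xs ⟩
  sumOver xs (λ x → sumBelow t (λ i → f i x)) + sumOver xs (f t)
    ≡⟨ cong (_+ sumOver xs (f t)) (sumOver-sumBelow f t xs) ⟩
  sumBelow t (λ i → sumOver xs (f i)) + sumOver xs (f t)   ∎
  where open ≡-Reasoning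

sumBelow-cong : ∀ t {f g : ℕ → ℕ} → (∀ i → i < t → f i ≡ g i) → sumBelow t f ≡ sumBelow t g
sumBelow-cong zero    _   = refl
sumBelow-cong (suc t) f≗g =
  cong₂ _+_ (sumBelow-cong t (λ i i<t → f≗g i (ℕ.m<n⇒m<1+n i<t))) (f≗g t ℕ.≤-refl)

sumBelow-const : ∀ t c → sumBelow t (λ _ → c) ≡ t * c
sumBelow-const zero    c = refl
sumBelow-const (suc t) c = trans (cong (_+ c) (sumBelow-const t c)) (ℕ.+-comm (t * c) c)

sumBelow-zero : ∀ t {f} → (∀ i → i < t → f i ≡ 0) → sumBelow t f ≡ 0
sumBelow-zero t f≡0 = trans (sumBelow-cong t f≡0) (trans (sumBelow-const t 0) (ℕ.*-zeroʳ t))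

sumBelow-constFrom : ∀ {k m} c (f : ℕ → ℕ) → k ≤ m → (∀ i → k ≤ i → i < m → f i ≡ c) →
                     sumBelow m f ≡ sumBelow k f + (m ∸ k) * c
sumBelow-constFrom {k} {m} c f k≤m f≡c with ℕ.m≤n⇒∃[o]m+o≡n k≤m
... | r , refl rewrite ℕ.m+n∸m≡n k r = go r ℕ.≤-refl
  where
  go : ∀ s → s ≤ r → sumBelow (k + s) f ≡ sumBelow k f + s * c
  go zero    _   rewrite ℕ.+-identityʳ k = sym (ℕ.+-identityʳ _)
  go (suc s) s<r rewrite ℕ.+-suc k s | go s (ℕ.<⇒≤ s<r)
                       | f≡c (k + s) (ℕ.m≤m+n k s) (ℕ.+-monoʳ-< k s<r) =
    trans (ℕ.+-assoc (sumBelow k f) (s * c) c) (cong (λ t → sumBelow k f + t) (ℕ.+-comm (s * c) c))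

indicator : {A : Set} → Dec A → ℕ
indicator a? = if does a? then 1 else 0

indicator-⇔ : {A B : Set} → A ⇔ B → (a? : Dec A) (b? : Dec B) → indicator a? ≡ indicator b?
indicator-⇔ A⇔B (yes _) (yes _) = refl
indicator-⇔ A⇔B (yes a) (no ¬b) = ⊥-elim (¬b (to A⇔B a))
indicator-⇔ A⇔B (no ¬a) (yes b) = ⊥-elim (¬a (from A⇔B b))
indicator-⇔ A⇔B (no _)  (no _)  = refl

indicator-no : {A : Set} → ¬ A → (a? : Dec A) → indicator a? ≡ 0
indicator-no ¬a (yes a) = ⊥-elim (¬a a)
indicator-no ¬a (no _)  = refl

indicator-yes : {A : Set} → A → (a? : Dec A) → indicator a? ≡ 1
indicator-yes a (yes _) = refl
indicator-yes a (no ¬a) = ⊥-elim (¬a a)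

sumBelow-indicator-≡ : ∀ {c m} → c < m → sumBelow m (λ i → indicator (c ℕ.≟ i)) ≡ 1
sumBelow-indicator-≡ {c} {m} c<m = begin
  sumBelow m [c≡_]
    ≡⟨ sumBelow-constFrom 0 [c≡_] c<m (λ i c<i _ → beyond-c i c<i) ⟩
  sumBelow c [c≡_] + [c≡ c ] + (m ∸ suc c) * 0
    ≡⟨ cong₂ (λ s t → s + t + (m ∸ suc c) * 0) below-c at-c ⟩
  0 + 1 + (m ∸ suc c) * 0
    ≡⟨ cong suc (ℕ.*-zeroʳ (m ∸ suc c)) ⟩
  1 ∎
  where
  open ≡-Reasoning
  [c≡_] : ℕ → ℕ
  [c≡ i ] = indicator (c ℕ.≟ i)
  beyond-c : ∀ i → c < i → [c≡ i ] ≡ 0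
  beyond-c i c<i = indicator-no (ℕ.<⇒≢ c<i) (c ℕ.≟ i)
  below-c : sumBelow c [c≡_] ≡ 0
  below-c = sumBelow-zero c λ i i<c → indicator-no (ℕ.>⇒≢ i<c) (c ℕ.≟ i)
  at-c : [c≡ c ] ≡ 1
  at-c = indicator-yes refl (c ℕ.≟ c)

HasCount-unique : {X : Set} {P : X → Set} {N M : ℕ} → HasCount P N → HasCount P M → N ≡ M
HasCount-unique (L , uL , L⇔P , refl) (K , uK , K⇔P , refl) =
  ↭.↭-length (∼bag⇒↭ (unique∧set⇒bag uL uK
    (λ {x} → mk⇔ (from (K⇔P x) ∘ to (L⇔P x)) (from (L⇔P x) ∘ to (K⇔P x)))))

HasCount-⇔ : {X : Set} {P Q : X → Set} {N : ℕ} → (∀ x → P x ⇔ Q x) → HasCount P N → HasCount Q N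
HasCount-⇔ P⇔Q (L , u , L⇔P , l) =
  L , u , (λ x → mk⇔ (to (P⇔Q x) ∘ to (L⇔P x)) (from (L⇔P x) ∘ from (P⇔Q x))) , l

HasCount-singleton : {X : Set} {P : X → Set} {Q : Set} (x₀ : X) → (∀ x → P x ⇔ (Q × x ≡ x₀)) →
                     (q? : Dec Q) → HasCount P (indicator q?)
HasCount-singleton x₀ P⇔Q×≡x₀ (yes q) =
  x₀ ∷ [] , All.[] ∷ [] ,
  (λ x → mk⇔ (λ { (here refl) → from (P⇔Q×≡x₀ x₀) (q , refl) })
             (λ px → here (proj₂ (to (P⇔Q×≡x₀ x) px)))) ,
  refl
HasCount-singleton x₀ P⇔Q×≡x₀ (no ¬q) =
  [] , [] , (λ x → mk⇔ (λ ()) (λ px → ⊥-elim (¬q (proj₁ (to (P⇔Q×≡x₀ x) px))))) , refl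

record Enumeration (A : Set) : Set where
  field
    list     : List A
    unique   : Unique list
    complete : ∀ x → x ∈ list

open Enumeration public

length-filter≡sumOver-indicator : {A : Set} {P : Pred A _} (P? : Decidable P) →
  ∀ xs → length (filter P? xs) ≡ sumOver xs (indicator ∘ P?)
length-filter≡sumOver-indicator P? []       = refl
length-filter≡sumOver-indicator P? (x ∷ xs) with does (P? x)
... | true  = cong suc (length-filter≡sumOver-indicator P? xs)
... | false = length-filter≡sumOver-indicator P? xs

count : {A : Set} → Enumeration A → {P : Pred A _} → Decidable P → ℕ
count E P? = sumOver (list E) (indicator ∘ P?)

count-HasCount : {A : Set} (E : Enumeration A) {P : Pred A _} (P? : Decidable P) →
                 HasCount P (count E P?)
count-HasCount E P? =
  filter P? (list E) ,
  Unique.filter⁺ P? (unique E) ,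
  (λ x → mk⇔ (proj₂ ∘ ∈.∈-filter⁻ P? {xs = list E}) (∈.∈-filter⁺ P? (complete E x))) ,
  length-filter≡sumOver-indicator P? (list E)

HasCount⇒≡count : {A : Set} (E : Enumeration A) {P : Pred A _} (P? : Decidable P) {N : ℕ} →
                  HasCount P N → N ≡ count E P?
HasCount⇒≡count E P? h = HasCount-unique h (count-HasCount E P?)

sumOver-involution : {A : Set} (E : Enumeration A) (σ : A → A) → (∀ x → σ (σ x) ≡ x) →
                     (f : A → ℕ) → sumOver (list E) (f ∘ σ) ≡ sumOver (list E) f
sumOver-involution E σ σσ f = begin
  sum (map (f ∘ σ) (list E))      ≡⟨ cong sum (List.map-∘ (list E)) ⟩
  sum (map f (map σ (list E)))    ≡⟨ sum-↭ (↭.map⁺ f σ[E]↭E) ⟩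
  sum (map f (list E))            ∎
  where
  open ≡-Reasoning
  σ-injective : ∀ {x y} → σ x ≡ σ y → x ≡ y
  σ-injective {x} {y} eq = trans (sym (σσ x)) (trans (cong σ eq) (σσ y))
  σ[E]↭E : map σ (list E) ↭ list E
  σ[E]↭E = ∼bag⇒↭ (unique∧set⇒bag (Unique.map⁺ σ-injective (unique E)) (unique E)
    (λ {x} → mk⇔ (λ _ → complete E x)
                 (λ _ → subst (_∈ map σ (list E)) (σσ x) (∈.∈-map⁺ σ (complete E (σ x))))))

vectors : {A : Set} → Enumeration A → ∀ n → Enumeration (Vec A n)
vectors E zero    = record { list = []ᵥ ∷ [] ; unique = All.[] ∷ [] ; complete = λ { []ᵥ → here refl } }
vectors {A} E (suc n) = record
  { list     = cartesianProductWith _∷ᵥ_ (list E) (list Eₙ)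
  ; unique   = Unique.cartesianProductWith⁺ _∷ᵥ_ Vec.∷-injective (unique E) (unique Eₙ)
  ; complete = λ { (x ∷ᵥ xs) → ∈.∈-cartesianProductWith⁺ _∷ᵥ_ (complete E x) (complete Eₙ xs) }
  }
  where
  Eₙ : Enumeration (Vec A n)
  Eₙ = vectors E n

lookup-extensionality : {A : Set} {n : ℕ} {xs ys : Vec A n} → (∀ i → lookup xs i ≡ lookup ys i) → xs ≡ ys
lookup-extensionality {xs = xs} {ys} xs≗ys =
  trans (sym (Vec.tabulate∘lookup xs)) (trans (Vec.tabulate-cong xs≗ys) (Vec.tabulate∘lookup ys))

-- Integer polynomials

infixl 6 _⊕_

_⊕_ : Poly → Poly → Poly
[]      ⊕ q       = q
(a ∷ p) ⊕ []      = a ∷ p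
(a ∷ p) ⊕ (b ∷ q) = (a +ℤ b) ∷ (p ⊕ q)

eval-⊕ : ∀ p q x → eval (p ⊕ q) x ≡ eval p x +ℤ eval q x
eval-⊕ []      q       x = sym (ℤ.+-identityˡ _)
eval-⊕ (a ∷ p) []      x = sym (ℤ.+-identityʳ _)
eval-⊕ (a ∷ p) (b ∷ q) x rewrite eval-⊕ p q x = lemma a b x (eval p x) (eval q x)
  where
  lemma : ∀ a b x u w → a +ℤ b +ℤ x *ℤ (u +ℤ w) ≡ a +ℤ x *ℤ u +ℤ (b +ℤ x *ℤ w)
  lemma = solve-∀

length-⊕ : ∀ {L} p q → length p ≤ L → length q ≤ L → length (p ⊕ q) ≤ L
length-⊕ []      q       _         hq        = hq
length-⊕ (a ∷ p) []      hp        _         = hp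
length-⊕ (a ∷ p) (b ∷ q) (s≤s hp) (s≤s hq) = s≤s (length-⊕ p q hp hq)

scale : ℤ → Poly → Poly
scale c []      = []
scale c (a ∷ p) = (c *ℤ a) ∷ scale c p

eval-scale : ∀ c p x → eval (scale c p) x ≡ c *ℤ eval p x
eval-scale c []      x = sym (ℤ.*-zeroʳ c)
eval-scale c (a ∷ p) x rewrite eval-scale c p x = lemma c a x (eval p x)
  where
  lemma : ∀ c a x u → c *ℤ a +ℤ x *ℤ (c *ℤ u) ≡ c *ℤ (a +ℤ x *ℤ u)
  lemma = solve-∀

X*_ : Poly → Poly
X* p = + 0 ∷ p

eval-X* : ∀ p x → eval (X* p) x ≡ x *ℤ eval p x
eval-X* p x = ℤ.+-identityˡ _

-- Horner's rule in the variable X + 1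
shift : Poly → Poly
shift []      = []
shift (a ∷ q) = (a ∷ []) ⊕ (shift q ⊕ X* shift q)

length-shift : ∀ p → length (shift p) ≤ length p
length-shift []      = z≤n
length-shift (a ∷ q) =
  length-⊕ (a ∷ []) (shift q ⊕ X* shift q) (s≤s z≤n)
    (length-⊕ (shift q) (X* shift q) (ℕ.m≤n⇒m≤1+n (length-shift q)) (s≤s (length-shift q)))

eval-shift : ∀ p x → eval (shift p) x ≡ eval p (+ 1 +ℤ x)
eval-shift []      x = refl
eval-shift (a ∷ q) x
  rewrite eval-⊕ (a ∷ []) (shift q ⊕ X* shift q) x
        | eval-⊕ (shift q) (X* shift q) x
        | eval-X* (shift q) x
        | eval-shift q x
  = lemma a x (eval q (+ 1 +ℤ x))
  where
  lemma : ∀ a x u → a +ℤ x *ℤ + 0 +ℤ (u +ℤ x *ℤ u) ≡ a +ℤ (+ 1 +ℤ x) *ℤ u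
  lemma = solve-∀

shiftBy : ℕ → Poly → Poly
shiftBy zero    p = p
shiftBy (suc k) p = shift (shiftBy k p)

eval-shiftBy : ∀ k p x → eval (shiftBy k p) x ≡ eval p (+ k +ℤ x)
eval-shiftBy zero    p x = cong (eval p) (sym (ℤ.+-identityˡ x))
eval-shiftBy (suc k) p x = begin
  eval (shift (shiftBy k p)) x     ≡⟨ eval-shift (shiftBy k p) x ⟩
  eval (shiftBy k p) (+ 1 +ℤ x)    ≡⟨ eval-shiftBy k p (+ 1 +ℤ x) ⟩
  eval p (+ k +ℤ (+ 1 +ℤ x))       ≡⟨ cong (eval p) (lemma (+ k) x) ⟩
  eval p (+ 1 +ℤ + k +ℤ x)         ∎
  where
  open ≡-Reasoning
  lemma : ∀ k x → k +ℤ (+ 1 +ℤ x) ≡ + 1 +ℤ k +ℤ x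
  lemma = solve-∀

-- Peeling off the constant term leaves q with q(y + 1) = 0 for all y, so the
-- induction continues with shift q, which is no longer than q.
vanishesOnℕ⇒vanishes : ∀ p → (∀ y → eval p (+ y) ≡ + 0) → ∀ x → eval p x ≡ + 0
vanishesOnℕ⇒vanishes p = go (length p) p ℕ.≤-refl
  where
  go : ∀ L p → length p ≤ L → (∀ y → eval p (+ y) ≡ + 0) → ∀ x → eval p x ≡ + 0
  go _       []      _       _  _ = refl
  go (suc L) (a ∷ q) (s≤s h) p≡0 x = begin
    a +ℤ x *ℤ eval q x    ≡⟨ cong₂ (λ a′ t → a′ +ℤ x *ℤ t) a≡0 (q≡0 x) ⟩
    + 0 +ℤ x *ℤ + 0       ≡⟨ cong (+ 0 +ℤ_) (ℤ.*-zeroʳ x) ⟩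
    + 0                   ∎
    where
    open ≡-Reasoning
    a≡0 : a ≡ + 0
    a≡0 = trans (sym (trans (cong (a +ℤ_) (ℤ.*-zeroˡ (eval q (+ 0)))) (ℤ.+-identityʳ a))) (p≡0 0)
    [1+y]*q≡0 : ∀ y → + suc y *ℤ eval q (+ suc y) ≡ + 0
    [1+y]*q≡0 y = trans (sym (ℤ.+-identityˡ _)) (trans (cong (_+ℤ _) (sym a≡0)) (p≡0 (suc y)))
    shift-q≡0 : ∀ y → eval (shift q) (+ y) ≡ + 0
    shift-q≡0 y with ℤ.i*j≡0⇒i≡0∨j≡0 (+ suc y) ([1+y]*q≡0 y)
    ... | inj₂ q≡0 = trans (eval-shift q (+ y)) q≡0
    q≡0 : ∀ x → eval q x ≡ + 0
    q≡0 x = begin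
      eval q x                     ≡⟨ cong (eval q) (sym (lemma x)) ⟩
      eval q (+ 1 +ℤ (x - + 1))    ≡⟨ sym (eval-shift q (x - + 1)) ⟩
      eval (shift q) (x - + 1)     ≡⟨ go L (shift q) (ℕ.≤-trans (length-shift q) h) shift-q≡0 (x - + 1) ⟩
      + 0                          ∎
      where
      lemma : ∀ x → + 1 +ℤ (x - + 1) ≡ x
      lemma = solve-∀

infixl 6 _⊖_

_⊖_ : Poly → Poly → Poly
p ⊖ q = p ⊕ scale (- + 1) q

eval-⊖ : ∀ p q x → eval (p ⊖ q) x ≡ eval p x - eval q x
eval-⊖ p q x rewrite eval-⊕ p (scale (- + 1) q) x | eval-scale (- + 1) q x =
  lemma (eval p x) (eval q x)
  where
  lemma : ∀ a b → a +ℤ - + 1 *ℤ b ≡ a - b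
  lemma = solve-∀

agreeAbove⇒agree : ∀ t p q → (∀ m → t ≤ m → eval p (+ m) ≡ eval q (+ m)) →
                   ∀ x → eval p x ≡ eval q x
agreeAbove⇒agree t p q agree x = ℤ.i-j≡0⇒i≡j _ _ (begin
  eval p x - eval q x                  ≡⟨ sym (eval-⊖ p q x) ⟩
  eval (p ⊖ q) x                       ≡⟨ cong (eval (p ⊖ q)) (sym (lemma (+ t) x)) ⟩
  eval (p ⊖ q) (+ t +ℤ (x - + t))      ≡⟨ sym (eval-shiftBy t (p ⊖ q) (x - + t)) ⟩
  eval (shiftBy t (p ⊖ q)) (x - + t)   ≡⟨ vanishesOnℕ⇒vanishes (shiftBy t (p ⊖ q)) shifted≡0 (x - + t) ⟩
  + 0                                  ∎)
  where
  open ≡-Reasoning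
  lemma : ∀ t x → t +ℤ (x - t) ≡ x
  lemma = solve-∀
  shifted≡0 : ∀ y → eval (shiftBy t (p ⊖ q)) (+ y) ≡ + 0
  shifted≡0 y = begin
    eval (shiftBy t (p ⊖ q)) (+ y)           ≡⟨ eval-shiftBy t (p ⊖ q) (+ y) ⟩
    eval (p ⊖ q) (+ (t + y))                 ≡⟨ eval-⊖ p q _ ⟩
    eval p (+ (t + y)) - eval q (+ (t + y))  ≡⟨ ℤ.i≡j⇒i-j≡0 (agree (t + y) (ℕ.m≤m+n t y)) ⟩
    + 0                                      ∎

mulXPlus : ℤ → Poly → Poly
mulXPlus a p = X* p ⊕ scale a p

eval-mulXPlus : ∀ a p x → eval (mulXPlus a p) x ≡ (x +ℤ a) *ℤ eval p x
eval-mulXPlus a p x rewrite eval-⊕ (X* p) (scale a p) x | eval-X* p x | eval-scale a p x =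
  sym (ℤ.*-distribʳ-+ (eval p x) x a)

sumPoly : ℕ → (ℕ → Poly) → Poly
sumPoly zero    F = []
sumPoly (suc t) F = sumPoly t F ⊕ F t

eval-sumPoly : ∀ t F x c (f : ℕ → ℕ) → (∀ i → i < t → eval (F i) x ≡ c *ℤ + f i) →
               eval (sumPoly t F) x ≡ c *ℤ + sumBelow t f
eval-sumPoly zero    F x c f _     = sym (ℤ.*-zeroʳ c)
eval-sumPoly (suc t) F x c f eval≡ = begin
  eval (sumPoly t F ⊕ F t) x
    ≡⟨ eval-⊕ (sumPoly t F) (F t) x ⟩
  eval (sumPoly t F) x +ℤ eval (F t) x
    ≡⟨ cong₂ _+ℤ_ (eval-sumPoly t F x c f λ i i<t → eval≡ i (ℕ.m<n⇒m<1+n i<t)) (eval≡ t ℕ.≤-refl) ⟩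
  c *ℤ + sumBelow t f +ℤ c *ℤ + f t
    ≡⟨ sym (ℤ.*-distribˡ-+ c _ _) ⟩
  c *ℤ (+ sumBelow t f +ℤ + f t)
    ≡⟨ cong (c *ℤ_) (sym (ℤ.pos-+ (sumBelow t f) (f t))) ⟩
  c *ℤ + sumBelow (suc t) f   ∎
  where open ≡-Reasoning

-- Directed paths

module _ {n : ℕ} (G : Graph n) (o : Orientation G) where

  infixr 5 _++ₚ_

  _++ₚ_ : ∀ {u v w} → Path G o u v → Path G o v w → Path G o u w
  arc a    ++ₚ q = a ∷ₚ q
  (a ∷ₚ p) ++ₚ q = a ∷ₚ (p ++ₚ q)

  arc? : ∀ u v → Dec (Arc G o u v)
  arc? u v = Fin.any? λ i →
    (edge≟ (lookup (edges G) i) (u , v) ×-dec (lookup o i Bool.≟ true)) ⊎-dec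
    (edge≟ (lookup (edges G) i) (v , u) ×-dec (lookup o i Bool.≟ false))
    where
    edge≟ : (x y : Fin n × Fin n) → Dec (x ≡ y)
    edge≟ = Product.≡-dec Fin._≟_ Fin._≟_

  -- paths with at most t + 1 arcs
  PathWithin : ℕ → Fin n → Fin n → Set
  PathWithin zero    u v = Arc G o u v
  PathWithin (suc t) u v = Arc G o u v ⊎ Σ (Fin n) λ w → Arc G o u w × PathWithin t w v

  pathWithin? : ∀ t u v → Dec (PathWithin t u v)
  pathWithin? zero    u v = arc? u v
  pathWithin? (suc t) u v = arc? u v ⊎-dec Fin.any? (λ w → arc? u w ×-dec pathWithin? t w v)

  PathWithin⇒Path : ∀ t {u v} → PathWithin t u v → Path G o u v
  PathWithin⇒Path zero    a                  = arc a
  PathWithin⇒Path (suc t) (inj₁ a)           = arc a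
  PathWithin⇒Path (suc t) (inj₂ (_ , a , p)) = a ∷ₚ PathWithin⇒Path t p

  -- A walk of length ℓ as a vertex sequence; only its first ℓ + 1 entries matter.
  Walk : ℕ → Fin n → Fin n → Set
  Walk ℓ u v = Σ (ℕ → Fin n) λ f → f 0 ≡ u × f ℓ ≡ v × (∀ p → p < ℓ → Arc G o (f p) (f (suc p)))

  Path⇒Walk : ∀ {u v} → Path G o u v → Σ ℕ λ ℓ → Walk (suc ℓ) u v
  Path⇒Walk {u} {v} (arc a) = 0 , f , refl , refl , λ { zero _ → a ; (suc _) (s≤s ()) }
    where
    f : ℕ → Fin n
    f zero    = u
    f (suc _) = v
  Path⇒Walk {u} (a ∷ₚ p) with Path⇒Walk p
  ... | ℓ , f , refl , fℓ≡v , arcs =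
    suc ℓ , g , refl , fℓ≡v , λ { zero _ → a ; (suc p) (s≤s p<ℓ) → arcs p p<ℓ }
    where
    g : ℕ → Fin n
    g zero    = u
    g (suc p) = f p

  Walk⇒PathWithin : ∀ ℓ t {u v} → ℓ ≤ t → Walk (suc ℓ) u v → PathWithin t u v
  Walk⇒PathWithin zero    zero    _         (f , refl , refl , arcs) = arcs 0 (s≤s z≤n)
  Walk⇒PathWithin zero    (suc t) _         (f , refl , refl , arcs) = inj₁ (arcs 0 (s≤s z≤n))
  Walk⇒PathWithin (suc ℓ) (suc t) (s≤s ℓ≤t) (f , refl , refl , arcs) =
    inj₂ (f 1 , arcs 0 (s≤s z≤n) ,
          Walk⇒PathWithin ℓ t ℓ≤t ((λ p → f (suc p)) , refl , refl , λ p p<ℓ → arcs (suc p) (s≤s p<ℓ)))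

  module _ {u v} i δ r (f : ℕ → Fin n) (f0 : f 0 ≡ u) (fℓ : f (i + δ + suc r) ≡ v)
           (arcs : ∀ p → p < i + δ + suc r → Arc G o (f p) (f (suc p))) (loop : f i ≡ f (i + δ)) where

    private
      skip : ℕ → ℕ
      skip p with p ℕ.≤? i
      ... | yes _ = p
      ... | no  _ = p + δ

      skip-≤ : ∀ {p} → p ≤ i → skip p ≡ p
      skip-≤ {p} p≤i with p ℕ.≤? i
      ... | yes _   = refl
      ... | no  p≰i = ⊥-elim (p≰i p≤i)

      skip-> : ∀ {p} → i < p → skip p ≡ p + δ
      skip-> {p} i<p with p ℕ.≤? i
      ... | yes p≤i = ⊥-elim (ℕ.<⇒≱ i<p p≤i)
      ... | no  _   = refl

      rearrange : ∀ i δ r → suc (i + r) + δ ≡ i + δ + suc r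
      rearrange = ℕ-Solver.solve-∀

      arcs′ : ∀ p → p < suc (i + r) → Arc G o (f (skip p)) (f (skip (suc p)))
      arcs′ p p<1+i+r with ℕ.<-cmp p i
      ... | tri< p<i _ _ rewrite skip-≤ (ℕ.<⇒≤ p<i) | skip-≤ p<i =
        arcs p (ℕ.<-≤-trans p<i (ℕ.≤-trans (ℕ.m≤m+n i δ) (ℕ.m≤m+n (i + δ) (suc r))))
      ... | tri≈ _ refl _ rewrite skip-≤ (ℕ.≤-refl {p}) | skip-> (ℕ.n<1+n p) | loop =
        arcs (p + δ) (ℕ.m<m+n (p + δ) (s≤s z≤n))
      ... | tri> _ _ i<p rewrite skip-> i<p | skip-> (ℕ.m<n⇒m<1+n i<p) =
        arcs (p + δ) (subst (p + δ <_) (rearrange i δ r) (ℕ.+-monoˡ-< δ p<1+i+r))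

    cutLoop : Walk (suc (i + r)) u v
    cutLoop = (λ p → f (skip p)) ,
              trans (cong f (skip-≤ z≤n)) f0 ,
              trans (cong f (trans (skip-> (s≤s (ℕ.m≤m+n i r))) (rearrange i δ r))) fℓ ,
              arcs′

  -- By pigeonhole two of the first ℓ + 1 positions carry the same vertex; cutting out the loop
  -- between them keeps the last arc, so the walk stays non-empty.
  shortenWalk : ∀ {ℓ u v} → n ≤ ℓ → Walk (suc ℓ) u v → Σ ℕ λ ℓ′ → ℓ′ < ℓ × Walk (suc ℓ′) u v
  shortenWalk {ℓ} n≤ℓ (f , f0 , fℓ , arcs)
    with Fin.pigeonhole (s≤s n≤ℓ) (λ (p : Fin (suc ℓ)) → f (toℕ p))
  ... | i , j , i<j , fi≡fj = cutAt (toℕ i) (toℕ j) i<j (ℕ.≤-pred (Fin.toℕ<n j)) fi≡fj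
    where
    cutAt : ∀ i j → i < j → j ≤ ℓ → f i ≡ f j → Σ ℕ λ ℓ′ → ℓ′ < ℓ × Walk (suc ℓ′) _ _
    cutAt i j i<j j≤ℓ fi≡fj with ℕ.m≤n⇒∃[o]m+o≡n i<j | ℕ.m≤n⇒∃[o]m+o≡n j≤ℓ
    ... | δ , refl | r , refl =
      i + r , i+r<ℓ ,
      cutLoop i (suc δ) r f f0 (trans (cong f (sym (length≡ i δ r))) fℓ)
              (λ p p<L → arcs p (subst (p <_) (sym (length≡ i δ r)) p<L))
              (trans fi≡fj (cong f (sym (ℕ.+-suc i δ))))
      where
      length≡ : ∀ i δ r → suc (suc i + δ + r) ≡ i + suc δ + suc r
      length≡ = ℕ-Solver.solve-∀
      i+r<ℓ : i + r < suc i + δ + r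
      i+r<ℓ = s≤s (ℕ.+-monoˡ-≤ r (ℕ.m≤m+n i δ))

  ShortWalk : Fin n → Fin n → Set
  ShortWalk u v = Σ ℕ λ ℓ → ℓ < n × Walk (suc ℓ) u v

  shortWalk : ∀ {u v} ℓ → Walk (suc ℓ) u v → ShortWalk u v
  shortWalk {u} {v} = <-rec (λ ℓ → Walk (suc ℓ) u v → ShortWalk u v) λ ℓ rec w →
    case ℓ ℕ.<? n of λ where
    (yes ℓ<n) → ℓ , ℓ<n , w
    (no  ℓ≮n) → let (ℓ′ , ℓ′<ℓ , w′) = shortenWalk (ℕ.≮⇒≥ ℓ≮n) w in rec ℓ′<ℓ w′

  path? : ∀ u v → Dec (Path G o u v)
  path? u v with pathWithin? n u v
  ... | yes p = yes (PathWithin⇒Path n p)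
  ... | no ¬p = no λ p → let (ℓ , w) = Path⇒Walk p ; (ℓ′ , ℓ′<n , w′) = shortWalk ℓ w in
                         ¬p (Walk⇒PathWithin ℓ′ n (ℕ.<⇒≤ ℓ′<n) w′)

-- Precolourings with natural-number colours

Precoloring : ℕ → Set
Precoloring n = Fin n → Maybe ℕ

recolour : ∀ {n} → (ℕ → ℕ) → Precoloring n → Precoloring n
recolour f d w = Maybe.map f (d w)

_[_≔_] : ∀ {n} → Precoloring n → Fin n → ℕ → Precoloring n
(d [ v ≔ i ]) w with w Fin.≟ v
... | yes _ = just i
... | no  _ = d w

≔-same : ∀ {n} (d : Precoloring n) v i → (d [ v ≔ i ]) v ≡ just i
≔-same d v i with v Fin.≟ v
... | yes _   = refl
... | no  v≢v = ⊥-elim (v≢v refl)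

≔-other : ∀ {n} (d : Precoloring n) {v w} i → w ≢ v → (d [ v ≔ i ]) w ≡ d w
≔-other d {v} {w} i w≢v with w Fin.≟ v
... | yes w≡v = ⊥-elim (w≢v w≡v)
... | no  _   = refl

coloured⇒≢ : ∀ {n} {d : Precoloring n} {v a x} → d v ≡ nothing → d a ≡ just x → a ≢ v
coloured⇒≢ dv≡nothing da≡x refl with trans (sym dv≡nothing) da≡x
... | ()

Bounded : ∀ {n} → Precoloring n → ℕ → Set
Bounded d m = ∀ w x → d w ≡ just x → x < m

Bounded-mono : ∀ {n} {d : Precoloring n} {t m} → t ≤ m → Bounded d t → Bounded d m
Bounded-mono t≤m bounded w x dw = ℕ.<-≤-trans (bounded w x dw) t≤m

colourBound : ∀ {n} → Precoloring n → ℕ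
colourBound {zero}  d = 0
colourBound {suc n} d = maybe suc 0 (d Fin.zero) ⊔ colourBound (d ∘ Fin.suc)

Bounded-colourBound : ∀ {n} (d : Precoloring n) → Bounded d (colourBound d)
Bounded-colourBound {suc n} d Fin.zero    x dw≡x rewrite dw≡x =
  ℕ.m≤m⊔n (suc x) (colourBound (d ∘ Fin.suc))
Bounded-colourBound {suc n} d (Fin.suc w) x dw≡x =
  ℕ.<-≤-trans (Bounded-colourBound (d ∘ Fin.suc) w x dw≡x) (ℕ.m≤n⊔m _ _)

colourBound-least : ∀ {n} (d : Precoloring n) {m} → Bounded d m → colourBound d ≤ m
colourBound-least {zero}  d bounded = z≤n
colourBound-least {suc n} d {m} bounded =
  ℕ.⊔-lub first (colourBound-least (d ∘ Fin.suc) (bounded ∘ Fin.suc))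
  where
  first : maybe suc 0 (d Fin.zero) ≤ m
  first with d Fin.zero in d0
  ... | just x  = bounded Fin.zero x d0
  ... | nothing = z≤n

record Insertion {n} (d d′ : Precoloring n) (v : Fin n) (c : ℕ) (f : ℕ → ℕ) : Set where
  field
    at-v      : d′ v ≡ just c
    elsewhere : ∀ {w} → w ≢ v → d′ w ≡ Maybe.map f (d w)

≔-Insertion : ∀ {n} (d : Precoloring n) v i → Insertion d (d [ v ≔ i ]) v i (λ x → x)
≔-Insertion d v i = record
  { at-v      = ≔-same d v i
  ; elsewhere = λ {w} w≢v → trans (≔-other d i w≢v) (sym (Maybe.map-id (d w))) }

recolour-≔-Insertion : ∀ {n} f (d : Precoloring n) v c → Insertion d ((recolour f d) [ v ≔ c ]) v c f
recolour-≔-Insertion f d v c = record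
  { at-v      = ≔-same (recolour f d) v c
  ; elsewhere = ≔-other (recolour f d) c }

module _ {n} {d : Precoloring n} {v : Fin n} where

  Insertion-recolour : ∀ {d′ c f} σ → Insertion d d′ v c f → Insertion d (recolour σ d′) v (σ c) (σ ∘ f)
  Insertion-recolour σ ins = record
    { at-v      = cong (Maybe.map σ) (Insertion.at-v ins)
    ; elsewhere = λ {w} w≢v →
        trans (cong (Maybe.map σ) (Insertion.elsewhere ins w≢v)) (sym (Maybe.map-∘ (d w))) }

  Insertion-unique : ∀ {d₁ d₂ c₁ c₂ f₁ f₂} → Insertion d d₁ v c₁ f₁ → Insertion d d₂ v c₂ f₂ →
                     c₁ ≡ c₂ → (∀ w x → d w ≡ just x → f₁ x ≡ f₂ x) → ∀ w → d₁ w ≡ d₂ w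
  Insertion-unique {f₁ = f₁} {f₂} ins₁ ins₂ c₁≡c₂ f₁≡f₂ w with w Fin.≟ v
  ... | yes refl = trans (Insertion.at-v ins₁) (trans (cong just c₁≡c₂) (sym (Insertion.at-v ins₂)))
  ... | no  w≢v  = trans (Insertion.elsewhere ins₁ w≢v)
                         (trans (agree (d w) refl) (sym (Insertion.elsewhere ins₂ w≢v)))
    where
    agree : ∀ r → d w ≡ r → Maybe.map f₁ r ≡ Maybe.map f₂ r
    agree nothing  _  = refl
    agree (just x) dw = cong just (f₁≡f₂ w x dw)

  Insertion-Bounded : ∀ {d′ c f m} → Insertion d d′ v c f → c < m → (∀ w x → d w ≡ just x → f x < m) →
                      Bounded d′ m
  Insertion-Bounded ins c<m f<m w x d′w≡x with w Fin.≟ v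
  ... | yes refl with trans (sym (Insertion.at-v ins)) d′w≡x
  ...   | refl = c<m
  Insertion-Bounded ins c<m f<m w x d′w≡x | no w≢v
    with d w in dw | trans (sym (Insertion.elsewhere ins w≢v)) d′w≡x
  ...   | just x₀ | refl = f<m w x₀ dw

record Uncoloured {n} (d : Precoloring n) (S : List (Fin n)) : Set where
  field
    distinct : Unique S
    members  : ∀ w → d w ≡ nothing ⇔ w ∈ S

uncoloured : ∀ {n} (d : Precoloring n) → Σ (List (Fin n)) (Uncoloured d)
uncoloured {n} d = filter isNothing? (allFin n) , record
  { distinct = Unique.filter⁺ isNothing? (Unique.allFin⁺ n)
  ; members  = λ w → mk⇔ (∈.∈-filter⁺ isNothing? (∈.∈-allFin w))
                         (proj₂ ∘ ∈.∈-filter⁻ isNothing? {xs = allFin n}) }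
  where
  isNothing? : ∀ w → Dec (d w ≡ nothing)
  isNothing? w with d w
  ... | nothing = yes refl
  ... | just _  = no λ ()

Insertion-Uncoloured : ∀ {n} {d d′ : Precoloring n} {v c f S} → Insertion d d′ v c f →
                       Uncoloured d (v ∷ S) → Uncoloured d′ S
Insertion-Uncoloured {d = d} {d′} {v} {f = f} {S} ins unc = record
  { distinct = AllPairs.tail distinct
  ; members  = λ w → mk⇔ (to-S w) (from-S w) }
  where
  open Insertion ins
  open Uncoloured unc
  v∉S : All (v ≢_) S
  v∉S = AllPairs.head distinct
  to-S : ∀ w → d′ w ≡ nothing → w ∈ S
  to-S w d′w≡nothing with w Fin.≟ v
  ... | yes refl with trans (sym at-v) d′w≡nothing
  ...   | ()
  to-S w d′w≡nothing | no w≢v with d w in dw | trans (sym (elsewhere w≢v)) d′w≡nothing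
  ...   | nothing | _ with to (members w) dw
  ...     | here w≡v  = ⊥-elim (w≢v w≡v)
  ...     | there w∈S = w∈S
  from-S : ∀ w → w ∈ S → d′ w ≡ nothing
  from-S w w∈S = trans (elsewhere (λ w≡v → All.lookup v∉S w∈S (sym w≡v)))
                       (cong (Maybe.map f) (from (members w) (there w∈S)))

shiftFrom : ℕ → ℕ → ℕ
shiftFrom j x with x ℕ.<? j
... | yes _ = x
... | no  _ = suc x

shiftFrom-< : ∀ {j x} → x < j → shiftFrom j x ≡ x
shiftFrom-< {j} {x} x<j with x ℕ.<? j
... | yes _   = refl
... | no  x≮j = ⊥-elim (x≮j x<j)

shiftFrom-≤ : ∀ j x → shiftFrom j x ≤ suc x
shiftFrom-≤ j x with x ℕ.<? j
... | yes _ = ℕ.n≤1+n x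
... | no  _ = ℕ.≤-refl

shiftFrom-mono : ∀ j {x y} → y ≤ x → shiftFrom j y ≤ shiftFrom j x
shiftFrom-mono j {x} {y} y≤x with y ℕ.<? j | x ℕ.<? j
... | yes _   | yes _   = y≤x
... | yes _   | no _    = ℕ.m≤n⇒m≤1+n y≤x
... | no  y≮j | yes x<j = ⊥-elim (y≮j (ℕ.≤-<-trans y≤x x<j))
... | no  _   | no _    = s≤s y≤x

shiftFrom-reflect : ∀ j {x y} → shiftFrom j y ≤ shiftFrom j x → y ≤ x
shiftFrom-reflect j {x} {y} sy≤sx with y ℕ.<? j | x ℕ.<? j
... | yes _   | yes _   = sy≤sx
... | yes y<j | no x≮j  = ℕ.<⇒≤ (ℕ.<-≤-trans y<j (ℕ.≮⇒≥ x≮j))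
... | no  y≮j | yes x<j = ⊥-elim (ℕ.<⇒≱ (ℕ.<-≤-trans x<j (ℕ.≮⇒≥ y≮j)) (ℕ.<⇒≤ sy≤sx))
... | no  _   | no _    = ℕ.≤-pred sy≤sx

shiftFrom-<⇔ : ∀ j x → shiftFrom j x < j ⇔ x < j
shiftFrom-<⇔ j x with x ℕ.<? j
... | yes _   = mk⇔ (λ x<j → x<j) (λ x<j → x<j)
... | no  x≮j = mk⇔ (λ 1+x<j → ⊥-elim (x≮j (ℕ.<⇒≤ 1+x<j)))
                    (λ x<j → ⊥-elim (x≮j x<j))

shiftFrom->⇔ : ∀ j y → j < shiftFrom j y ⇔ j ≤ y
shiftFrom->⇔ j y with y ℕ.<? j
... | yes y<j = mk⇔ (λ j<y → ⊥-elim (ℕ.<-asym j<y y<j)) (λ j≤y → ⊥-elim (ℕ.<⇒≱ y<j j≤y))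
... | no  _   = mk⇔ ℕ.≤-pred s≤s

_[_≔↑_] : ∀ {n} → Precoloring n → Fin n → ℕ → Precoloring n
d [ v ≔↑ j ] = (recolour (shiftFrom j) d) [ v ≔ j ]

swap : ℕ → ℕ → ℕ → ℕ
swap a b x with x ℕ.≟ a
... | yes _ = b
... | no  _ with x ℕ.≟ b
...   | yes _ = a
...   | no  _ = x

swap-fixes : ∀ a b x → x ≢ a → x ≢ b → swap a b x ≡ x
swap-fixes a b x x≢a x≢b with x ℕ.≟ a
... | yes x≡a = ⊥-elim (x≢a x≡a)
... | no  _ with x ℕ.≟ b
...   | yes x≡b = ⊥-elim (x≢b x≡b)
...   | no  _   = refl

swap-left : ∀ a b → swap a b a ≡ b
swap-left a b with a ℕ.≟ a
... | yes _   = refl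
... | no  a≢a = ⊥-elim (a≢a refl)

swap-right : ∀ a b → swap a b b ≡ a
swap-right a b with b ℕ.≟ a
... | yes b≡a = b≡a
... | no  _ with b ℕ.≟ b
...   | yes _   = refl
...   | no  b≢b = ⊥-elim (b≢b refl)

swap-involutive : ∀ a b x → swap a b (swap a b x) ≡ x
swap-involutive a b x with x ℕ.≟ a
... | yes refl = swap-right x b
... | no  x≢a with x ℕ.≟ b
...   | yes refl = swap-left a x
...   | no  x≢b = swap-fixes a b x x≢a x≢b

swap-< : ∀ {a b m} → a < m → b < m → ∀ x → x < m → swap a b x < m
swap-< {a} {b} a<m b<m x x<m with x ℕ.≟ a
... | yes _ = b<m
... | no  _ with x ℕ.≟ b
...   | yes _ = a<m
...   | no  _ = x<m

shiftFrom-swap : ∀ j x → shiftFrom j x ≡ swap j (suc j) (shiftFrom (suc j) x)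
shiftFrom-swap j x with x ℕ.<? j | x ℕ.<? suc j
... | yes x<j | yes _     = sym (swap-fixes j (suc j) x (ℕ.<⇒≢ x<j) (ℕ.<⇒≢ (ℕ.m<n⇒m<1+n x<j)))
... | yes x<j | no  x≮1+j = ⊥-elim (x≮1+j (ℕ.m<n⇒m<1+n x<j))
... | no  x≮j | yes x<1+j rewrite ℕ.≤-antisym (ℕ.≤-pred x<1+j) (ℕ.≮⇒≥ x≮j) = sym (swap-left j (suc j))
... | no  x≮j | no  x≮1+j = sym (swap-fixes j (suc j) (suc x) 1+x≢j 1+x≢1+j)
  where
  1+x≢j : suc x ≢ j
  1+x≢j 1+x≡j = x≮j (subst (x <_) 1+x≡j ℕ.≤-refl)
  1+x≢1+j : suc x ≢ suc j
  1+x≢1+j 1+x≡1+j = x≮1+j (subst (_< suc j) (sym (ℕ.suc-injective 1+x≡1+j)) ℕ.≤-refl)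

module _ {n : ℕ} (G : Graph n) where

  src tgt : Fin (e G) → Fin n
  src i = proj₁ (lookup (edges G) i)
  tgt i = proj₂ (lookup (edges G) i)

  Extendsℕ : ∀ {m} → Precoloring n → Coloring n m → Set
  Extendsℕ d ĉ = ∀ w x → d w ≡ just x → toℕ (lookup ĉ w) ≡ x

  ProperExtensionℕ : Precoloring n → (m : ℕ) → Coloring n m → Set
  ProperExtensionℕ d m ĉ = Proper G ĉ × Extendsℕ d ĉ

  Compatibleℕ : Precoloring n → Orientation G → Set
  Compatibleℕ d o = ∀ a b x y → d a ≡ just x → d b ≡ just y → y ≤ x → ¬ Path G o a b

  Good : Precoloring n → Orientation G → Set
  Good d o = Acyclic G o × Compatibleℕ d o

  proper? : ∀ {m} (ĉ : Coloring n m) → Dec (Proper G ĉ)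
  proper? {m} ĉ = Dec.map′ proper properOnEdges (Fin.all? λ i → ¬? (colour (src i) Fin.≟ colour (tgt i)))
    where
    colour : Fin n → Fin m
    colour = lookup ĉ
    proper : (∀ i → colour (src i) ≢ colour (tgt i)) → Proper G ĉ
    proper h u v (i , refl) = h i
    properOnEdges : Proper G ĉ → ∀ i → colour (src i) ≢ colour (tgt i)
    properOnEdges h i = h (src i) (tgt i) (i , refl)

  extendsℕ? : ∀ {m} (d : Precoloring n) (ĉ : Coloring n m) → Dec (Extendsℕ d ĉ)
  extendsℕ? d ĉ = Fin.all? agreesAt?
    where
    agreesAt? : ∀ w → Dec (∀ x → d w ≡ just x → toℕ (lookup ĉ w) ≡ x)
    agreesAt? w with d w
    ... | nothing = yes λ _ ()
    ... | just x  = Dec.map′ (λ { eq _ refl → eq }) (λ h → h x refl) (toℕ (lookup ĉ w) ℕ.≟ x)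

  compatibleℕ? : ∀ d o → Dec (Compatibleℕ d o)
  compatibleℕ? d o = Fin.all? λ a → Fin.all? λ b → compatibleAt? a b
    where
    compatibleAt? : ∀ a b → Dec (∀ x y → d a ≡ just x → d b ≡ just y → y ≤ x → ¬ Path G o a b)
    compatibleAt? a b with d a | d b
    ... | nothing | _      = yes λ _ _ ()
    ... | just x  | nothing = yes λ _ _ _ ()
    ... | just x  | just y with y ℕ.≤? x | path? G o a b
    ...   | no  y≰x | _      = yes λ { _ _ refl refl y≤x → ⊥-elim (y≰x y≤x) }
    ...   | yes _   | no ¬p  = yes λ { _ _ refl refl _ → ¬p }
    ...   | yes y≤x | yes p  = no λ h → h x y refl refl y≤x p

  properExtensionℕ? : ∀ d m ĉ → Dec (ProperExtensionℕ d m ĉ)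
  properExtensionℕ? d m ĉ = proper? ĉ ×-dec extendsℕ? d ĉ

  acyclic? : ∀ o → Dec (Acyclic G o)
  acyclic? o = Fin.all? λ v → ¬? (path? G o v v)

  good? : ∀ d o → Dec (Good d o)
  good? d o = acyclic? o ×-dec compatibleℕ? d o

  colourings : ∀ m → Enumeration (Coloring n m)
  colourings m = vectors (record { list = allFin m ; unique = Unique.allFin⁺ m ; complete = ∈.∈-allFin }) n

  orientations : Enumeration (Orientation G)
  orientations = vectors (record { list = true ∷ false ∷ [] ; unique = ((λ ()) ∷ []) ∷ [] ∷ []
                                 ; complete = λ { true → here refl ; false → there (here refl) } })
                         (e G)

  #extensions : Precoloring n → ℕ → ℕ
  #extensions d m = count (colourings m) (properExtensionℕ? d m)

  #good : Precoloring n → ℕ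
  #good d = count orientations (good? d)

-- Good orientations after colouring one more vertex

-- Lo holds on some [j₀, ∞) and Hi on some [0, j₁] with j₀ ≤ j₁, so the two sums count the
-- same interval of integers, the second one without its right end.
module _ (Lo Hi : ℕ → Set) (lo? : ∀ j → Dec (Lo j)) (hi? : ∀ j → Dec (Hi j))
         (Lo-suc : ∀ j → Lo j → Lo (suc j)) (Hi-zero : Hi 0) (¬Lo⇒Hi-suc : ∀ j → ¬ Lo j → Hi (suc j)) where

  private
    count-with-Lo : ∀ K → sumBelow (suc K) (λ j → indicator (lo? j ×-dec hi? j)) ≡
                          indicator (lo? K) + sumBelow K (λ i → indicator (lo? i ×-dec hi? (suc i)))
    count-with-Lo zero with lo? 0 | hi? 0
    ... | yes _ | yes _   = refl
    ... | yes _ | no ¬hi  = ⊥-elim (¬hi Hi-zero)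
    ... | no _  | _       = refl
    count-with-Lo (suc K) rewrite count-with-Lo K with lo? K | lo? (suc K) | hi? (suc K)
    ... | yes lo | no ¬lo′ | _      = ⊥-elim (¬lo′ (Lo-suc K lo))
    ... | no ¬lo | _       | no ¬hi = ⊥-elim (¬hi (¬Lo⇒Hi-suc K ¬lo))
    ... | yes _  | yes _   | yes _  = refl
    ... | yes _  | yes _   | no _   = refl
    ... | no _   | yes _   | yes _  = trans (ℕ.+-comm _ 1) (cong suc (sym (ℕ.+-identityʳ _)))
    ... | no _   | no _    | yes _  = refl

  interval-count : ∀ K → Lo K → sumBelow (suc K) (λ j → indicator (lo? j ×-dec hi? j)) ≡
                                  suc (sumBelow K (λ i → indicator (lo? i ×-dec hi? (suc i))))
  interval-count K lo rewrite count-with-Lo K with lo? K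
  ... | yes _  = refl
  ... | no ¬lo = ⊥-elim (¬lo lo)

module _ {n : ℕ} (G : Graph n) (d : Precoloring n) (v : Fin n) where

  Before After : Orientation G → (ℕ → Set) → Set
  Before o P = ∀ a x → d a ≡ just x → Path G o a v → P x
  After  o P = ∀ b y → d b ≡ just y → Path G o v b → P y

  before? : ∀ o {P : ℕ → Set} → (∀ x → Dec (P x)) → Dec (Before o P)
  before? o P? = Fin.all? beforeAt?
    where
    beforeAt? : ∀ a → Dec (∀ x → d a ≡ just x → Path G o a v → _)
    beforeAt? a with d a
    ... | nothing = yes λ _ ()
    ... | just x with P? x | path? G o a v
    ...   | yes px | _     = yes λ { _ refl _ → px }
    ...   | no _   | no ¬p = yes λ { _ refl p → ⊥-elim (¬p p) }
    ...   | no ¬px | yes p = no λ h → ¬px (h x refl p)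

  after? : ∀ o {P : ℕ → Set} → (∀ x → Dec (P x)) → Dec (After o P)
  after? o P? = Fin.all? afterAt?
    where
    afterAt? : ∀ b → Dec (∀ y → d b ≡ just y → Path G o v b → _)
    afterAt? b with d b
    ... | nothing = yes λ _ ()
    ... | just y with P? y | path? G o v b
    ...   | yes py | _     = yes λ { _ refl _ → py }
    ...   | no _   | no ¬p = yes λ { _ refl p → ⊥-elim (¬p p) }
    ...   | no ¬py | yes p = no λ h → ¬py (h y refl p)

module _ {n : ℕ} (G : Graph n) (d : Precoloring n) (v : Fin n) (dv≡nothing : d v ≡ nothing) where

  module _ {d′ : Precoloring n} {c : ℕ} {f : ℕ → ℕ} (ins : Insertion d d′ v c f)
           (f-mono : ∀ {x y} → y ≤ x → f y ≤ f x) (f-reflect : ∀ {x y} → f y ≤ f x → y ≤ x)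
           (o : Orientation G) where

    open Insertion ins

    private
      d′-coloured : ∀ {a x} → d a ≡ just x → d′ a ≡ just (f x)
      d′-coloured da≡x = trans (elsewhere (coloured⇒≢ dv≡nothing da≡x)) (cong (Maybe.map f) da≡x)

      d-coloured : ∀ {a x} → a ≢ v → d′ a ≡ just x → Σ ℕ λ x₀ → d a ≡ just x₀ × f x₀ ≡ x
      d-coloured {a} a≢v d′a≡x with d a | trans (sym (elsewhere a≢v)) d′a≡x
      ... | just x₀ | refl = x₀ , refl , refl

      colour-v : ∀ {x} → d′ v ≡ just x → x ≡ c
      colour-v d′v≡x with trans (sym at-v) d′v≡x
      ... | refl = refl

    Good-Insertion⇒ : Good G d′ o →
                      Good G d o × Before G d v o (λ x → f x < c) × After G d v o (λ y → c < f y)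
    Good-Insertion⇒ (acyclic , compatible′) = (acyclic , compatible) , before , after
      where
      compatible : Compatibleℕ G d o
      compatible a b x y da db y≤x =
        compatible′ a b (f x) (f y) (d′-coloured da) (d′-coloured db) (f-mono y≤x)
      before : Before G d v o (λ x → f x < c)
      before a x da p with f x ℕ.<? c
      ... | yes fx<c = fx<c
      ... | no  fx≮c = ⊥-elim (compatible′ a v (f x) c (d′-coloured da) at-v (ℕ.≮⇒≥ fx≮c) p)
      after : After G d v o (λ y → c < f y)
      after b y db p with c ℕ.<? f y
      ... | yes c<fy = c<fy
      ... | no  c≮fy = ⊥-elim (compatible′ v b c (f y) at-v (d′-coloured db) (ℕ.≮⇒≥ c≮fy) p)

    Good-Insertion⇐ : Good G d o × Before G d v o (λ x → f x < c) × After G d v o (λ y → c < f y) →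
                      Good G d′ o
    Good-Insertion⇐ ((acyclic , compatible) , before , after) = acyclic , compatible′
      where
      compatible′ : Compatibleℕ G d′ o
      compatible′ a b x y d′a d′b y≤x p with a Fin.≟ v | b Fin.≟ v
      ... | yes refl | yes refl = acyclic v p
      ... | yes refl | no b≢v with d-coloured b≢v d′b | colour-v d′a
      ...   | y₀ , db , refl | refl = ℕ.<⇒≱ (after b y₀ db p) y≤x
      compatible′ a b x y d′a d′b y≤x p | no a≢v | yes refl with d-coloured a≢v d′a | colour-v d′b
      ...   | x₀ , da , refl | refl = ℕ.<⇒≱ (before a x₀ da p) y≤x
      compatible′ a b x y d′a d′b y≤x p | no a≢v | no b≢v with d-coloured a≢v d′a | d-coloured b≢v d′b
      ...   | x₀ , da , refl | y₀ , db , refl = compatible a b x₀ y₀ da db (f-reflect y≤x) p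

    Good-Insertion : Good G d′ o ⇔
                     (Good G d o × Before G d v o (λ x → f x < c) × After G d v o (λ y → c < f y))
    Good-Insertion = mk⇔ Good-Insertion⇒ Good-Insertion⇐

  Lo Hi : Orientation G → ℕ → Set
  Lo o j = Before G d v o (_< j)
  Hi o j = After  G d v o (j ≤_)

  Good-≔ : ∀ o i → Good G (d [ v ≔ i ]) o ⇔ (Good G d o × Lo o i × Hi o (suc i))
  Good-≔ o i = Good-Insertion (≔-Insertion d v i) (λ y≤x → y≤x) (λ y≤x → y≤x) o

  Good-≔↑ : ∀ o j → Good G (d [ v ≔↑ j ]) o ⇔ (Good G d o × Lo o j × Hi o j)
  Good-≔↑ o j = mk⇔
    (λ good → let (g , lo , hi) = to char good in
       g , (λ a x da p → to (shiftFrom-<⇔ j x) (lo a x da p)) ,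
           (λ b y db p → to (shiftFrom->⇔ j y) (hi b y db p)))
    (λ (g , lo , hi) → from char
       (g , (λ a x da p → from (shiftFrom-<⇔ j x) (lo a x da p)) ,
            (λ b y db p → from (shiftFrom->⇔ j y) (hi b y db p))))
    where
    char : Good G (d [ v ≔↑ j ]) o ⇔
           (Good G d o × Before G d v o (λ x → shiftFrom j x < j) × After G d v o (λ y → j < shiftFrom j y))
    char = Good-Insertion (recolour-≔-Insertion (shiftFrom j) d v j) (shiftFrom-mono j) (shiftFrom-reflect j) o

  private
    lo? : ∀ o j → Dec (Lo o j)
    lo? o j = before? G d v o (λ x → x ℕ.<? j)

    hi? : ∀ o j → Dec (Hi o j)
    hi? o j = after? G d v o (λ y → j ℕ.≤? y)

  -- A vertex before v coloured at least j is below every vertex after v.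
  ¬Lo⇒Hi-suc : ∀ o → Good G d o → ∀ j → ¬ Lo o j → Hi o (suc j)
  ¬Lo⇒Hi-suc o (_ , compatible) j ¬lo b y db v⇝b with suc j ℕ.≤? y
  ... | yes j<y = j<y
  ... | no  j≮y = ⊥-elim (¬lo λ a x da a⇝v → ℕ.<-≤-trans (x<y a x da a⇝v) (ℕ.≤-pred (ℕ.≰⇒> j≮y)))
    where
    x<y : ∀ a x → d a ≡ just x → Path G o a v → x < y
    x<y a x da a⇝v = ℕ.≰⇒> λ y≤x → compatible a b x y da db y≤x (_++ₚ_ G o a⇝v v⇝b)

  #good-pointwise : ∀ k → Bounded d k → ∀ o →
    indicator (good? G d o) + sumBelow k (λ i → indicator (good? G (d [ v ≔ i ]) o)) ≡
    sumBelow (suc k) (λ j → indicator (good? G (d [ v ≔↑ j ]) o))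
  #good-pointwise k bounded o = by-cases (good? G d o)
    where
    [≔_] [≔↑_] [Lo∧Hi-suc_] [Lo∧Hi_] : ℕ → ℕ
    [≔ i ]         = indicator (good? G (d [ v ≔ i ]) o)
    [≔↑ j ]        = indicator (good? G (d [ v ≔↑ j ]) o)
    [Lo∧Hi-suc i ] = indicator (lo? o i ×-dec hi? o (suc i))
    [Lo∧Hi j ]     = indicator (lo? o j ×-dec hi? o j)
    by-cases : (good-d? : Dec (Good G d o)) → indicator good-d? + sumBelow k [≔_] ≡ sumBelow (suc k) [≔↑_]
    by-cases (no ¬good) =
      trans (sumBelow-zero k λ i _ → indicator-no (¬good ∘ proj₁ ∘ to (Good-≔ o i)) (good? G (d [ v ≔ i ]) o))
            (sym (sumBelow-zero (suc k) λ j _ →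
                    indicator-no (¬good ∘ proj₁ ∘ to (Good-≔↑ o j)) (good? G (d [ v ≔↑ j ]) o)))
    by-cases (yes good) = begin
      suc (sumBelow k [≔_])                ≡⟨ cong suc (sumBelow-cong k λ i _ → ≔⇔ i) ⟩
      suc (sumBelow k [Lo∧Hi-suc_])        ≡⟨ sym (interval-count (Lo o) (Hi o) (lo? o) (hi? o) Lo-suc Hi-zero
                                                                  (¬Lo⇒Hi-suc o good) k Lo-k) ⟩
      sumBelow (suc k) [Lo∧Hi_]            ≡⟨ sumBelow-cong (suc k) (λ j _ → sym (≔↑⇔ j)) ⟩
      sumBelow (suc k) [≔↑_]               ∎
      where
      open ≡-Reasoning
      given-good : ∀ {A B : Set} → A ⇔ (Good G d o × B) → A ⇔ B
      given-good A⇔good×B = mk⇔ (proj₂ ∘ to A⇔good×B) (λ b → from A⇔good×B (good , b))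
      ≔⇔ : ∀ i → [≔ i ] ≡ [Lo∧Hi-suc i ]
      ≔⇔ i = indicator-⇔ (given-good (Good-≔ o i)) (good? G (d [ v ≔ i ]) o) (lo? o i ×-dec hi? o (suc i))
      ≔↑⇔ : ∀ j → [≔↑ j ] ≡ [Lo∧Hi j ]
      ≔↑⇔ j = indicator-⇔ (given-good (Good-≔↑ o j)) (good? G (d [ v ≔↑ j ]) o) (lo? o j ×-dec hi? o j)
      Lo-suc : ∀ j → Lo o j → Lo o (suc j)
      Lo-suc j lo a x da p = ℕ.m<n⇒m<1+n (lo a x da p)
      Hi-zero : Hi o 0
      Hi-zero _ _ _ _ = z≤n
      Lo-k : Lo o k
      Lo-k a x da _ = bounded a x da

  #good-recurrence : ∀ k → Bounded d k →
    #good G d + sumBelow k (λ i → #good G (d [ v ≔ i ])) ≡ sumBelow (suc k) (λ j → #good G (d [ v ≔↑ j ]))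
  #good-recurrence k bounded = begin
    sumOver os [d] + sumBelow k (λ i → sumOver os [d≔ i ])
      ≡⟨ cong (λ t → sumOver os [d] + t) (sym (sumOver-sumBelow [d≔_] k os)) ⟩
    sumOver os [d] + sumOver os (λ o → sumBelow k (λ i → [d≔ i ] o))
      ≡⟨ sym (sumOver-+ [d] _ os) ⟩
    sumOver os (λ o → [d] o + sumBelow k (λ i → [d≔ i ] o))
      ≡⟨ sumOver-cong (#good-pointwise k bounded) os ⟩
    sumOver os (λ o → sumBelow (suc k) (λ j → [d≔↑ j ] o))
      ≡⟨ sumOver-sumBelow [d≔↑_] (suc k) os ⟩
    sumBelow (suc k) (λ j → sumOver os [d≔↑ j ])   ∎
    where
    open ≡-Reasoning
    os : List (Orientation G)
    os = list (orientations G)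
    [d] : Orientation G → ℕ
    [d] o = indicator (good? G d o)
    [d≔_] [d≔↑_] : ℕ → Orientation G → ℕ
    [d≔ i ] o  = indicator (good? G (d [ v ≔ i ]) o)
    [d≔↑ j ] o = indicator (good? G (d [ v ≔↑ j ]) o)

-- Proper extensions after colouring one more vertex

module _ {n : ℕ} (G : Graph n) where

  #extensions-cong : ∀ {d d′ : Precoloring n} m → (∀ w → d w ≡ d′ w) →
                     #extensions G d m ≡ #extensions G d′ m
  #extensions-cong {d} {d′} m d≗d′ = sumOver-cong
    (λ ĉ → indicator-⇔ (same ĉ) (properExtensionℕ? G d m ĉ) (properExtensionℕ? G d′ m ĉ))
    (list (colourings G m))
    where
    same : ∀ ĉ → ProperExtensionℕ G d m ĉ ⇔ ProperExtensionℕ G d′ m ĉ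
    same ĉ = mk⇔ (λ (p , ext) → p , λ w x e → ext w x (trans (d≗d′ w) e))
                 (λ (p , ext) → p , λ w x e → ext w x (trans (sym (d≗d′ w)) e))

  Extendsℕ-≔ : ∀ {m} {d : Precoloring n} {v} i (ĉ : Coloring n m) → d v ≡ nothing →
               Extendsℕ G (d [ v ≔ i ]) ĉ ⇔ (Extendsℕ G d ĉ × toℕ (lookup ĉ v) ≡ i)
  Extendsℕ-≔ {d = d} {v} i ĉ dv≡nothing = mk⇔
    (λ ext → (λ w x dw≡x → ext w x (trans (≔-other d i (coloured⇒≢ dv≡nothing dw≡x)) dw≡x)) ,
             ext v i (≔-same d v i))
    (λ (ext , ĉv≡i) w x e → at w x e ext ĉv≡i)
    where
    at : ∀ w x → (d [ v ≔ i ]) w ≡ just x → Extendsℕ G d ĉ → toℕ (lookup ĉ v) ≡ i →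
         toℕ (lookup ĉ w) ≡ x
    at w x e ext ĉv≡i with w Fin.≟ v
    at w x refl ext ĉv≡i | yes refl = ĉv≡i
    ... | no w≢v = ext w x e

  #extensions-partition : ∀ {d : Precoloring n} {v} m → d v ≡ nothing →
                          #extensions G d m ≡ sumBelow m (λ i → #extensions G (d [ v ≔ i ]) m)
  #extensions-partition {d} {v} m dv≡nothing = begin
    sumOver cs [d]
      ≡⟨ sumOver-cong (λ ĉ → pointwise ĉ (properExtensionℕ? G d m ĉ)) cs ⟩
    sumOver cs (λ ĉ → sumBelow m (λ i → [d≔ i ] ĉ))
      ≡⟨ sumOver-sumBelow [d≔_] m cs ⟩
    sumBelow m (λ i → sumOver cs [d≔ i ])   ∎
    where
    open ≡-Reasoning
    cs : List (Coloring n m)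
    cs = list (colourings G m)
    [d] : Coloring n m → ℕ
    [d] ĉ = indicator (properExtensionℕ? G d m ĉ)
    [d≔_] : ℕ → Coloring n m → ℕ
    [d≔ i ] ĉ = indicator (properExtensionℕ? G (d [ v ≔ i ]) m ĉ)
    pointwise : ∀ ĉ (pe? : Dec (ProperExtensionℕ G d m ĉ)) → indicator pe? ≡ sumBelow m (λ i → [d≔ i ] ĉ)
    pointwise ĉ (no ¬pe) = sym (sumBelow-zero m λ i _ →
      indicator-no (λ (p , ext) → ¬pe (p , proj₁ (to (Extendsℕ-≔ i ĉ dv≡nothing) ext)))
                   (properExtensionℕ? G (d [ v ≔ i ]) m ĉ))
    pointwise ĉ (yes (p , ext)) = sym (begin
      sumBelow m (λ i → [d≔ i ] ĉ)
        ≡⟨ sumBelow-cong m (λ i _ →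
             indicator-⇔ (colour-v≡ i) (properExtensionℕ? G (d [ v ≔ i ]) m ĉ) (toℕ (lookup ĉ v) ℕ.≟ i)) ⟩
      sumBelow m (λ i → indicator (toℕ (lookup ĉ v) ℕ.≟ i))
        ≡⟨ sumBelow-indicator-≡ (Fin.toℕ<n (lookup ĉ v)) ⟩
      1 ∎)
      where
      colour-v≡ : ∀ i → ProperExtensionℕ G (d [ v ≔ i ]) m ĉ ⇔ (toℕ (lookup ĉ v) ≡ i)
      colour-v≡ i = mk⇔ (proj₂ ∘ to (Extendsℕ-≔ i ĉ dv≡nothing) ∘ proj₂)
                        (λ ĉv≡i → p , from (Extendsℕ-≔ i ĉ dv≡nothing) (ext , ĉv≡i))

  Proper-map⁻ : ∀ {m} (f : Fin m → Fin m) (ĉ : Coloring n m) → Proper G (Vec.map f ĉ) → Proper G ĉ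
  Proper-map⁻ f ĉ proper u v adj ĉu≡ĉv =
    proper u v adj (trans (Vec.lookup-map u f ĉ) (trans (cong f ĉu≡ĉv) (sym (Vec.lookup-map v f ĉ))))

  module _ {m} (σ : ℕ → ℕ) (σ-involutive : ∀ x → σ (σ x) ≡ x) (σ-< : ∀ x → x < m → σ x < m) where

    private
      σᶠ : Fin m → Fin m
      σᶠ x = fromℕ< (σ-< (toℕ x) (Fin.toℕ<n x))

      toℕ-σᶠ : ∀ x → toℕ (σᶠ x) ≡ σ (toℕ x)
      toℕ-σᶠ x = Fin.toℕ-fromℕ< _

      σᶠ-involutive : ∀ x → σᶠ (σᶠ x) ≡ x
      σᶠ-involutive x =
        Fin.toℕ-injective (trans (toℕ-σᶠ (σᶠ x)) (trans (cong σ (toℕ-σᶠ x)) (σ-involutive (toℕ x))))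

      σᶜ : Coloring n m → Coloring n m
      σᶜ = Vec.map σᶠ

      σᶜ-involutive : ∀ ĉ → σᶜ (σᶜ ĉ) ≡ ĉ
      σᶜ-involutive ĉ =
        trans (sym (Vec.map-∘ σᶠ σᶠ ĉ)) (trans (Vec.map-cong σᶠ-involutive ĉ) (Vec.map-id ĉ))

      toℕ-σᶜ : ∀ ĉ w → toℕ (lookup (σᶜ ĉ) w) ≡ σ (toℕ (lookup ĉ w))
      toℕ-σᶜ ĉ w = trans (cong toℕ (Vec.lookup-map w σᶠ ĉ)) (toℕ-σᶠ (lookup ĉ w))

      ProperExtension-recolour : ∀ d ĉ →
                                 ProperExtensionℕ G (recolour σ d) m ĉ ⇔ ProperExtensionℕ G d m (σᶜ ĉ)
      ProperExtension-recolour d ĉ = mk⇔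
        (λ (proper , ext) →
           Proper-map⁻ σᶠ (σᶜ ĉ) (subst (Proper G) (sym (σᶜ-involutive ĉ)) proper) ,
           λ w x dw≡x → trans (toℕ-σᶜ ĉ w)
                              (trans (cong σ (ext w (σ x) (cong (Maybe.map σ) dw≡x))) (σ-involutive x)))
        (λ (proper , ext) → Proper-map⁻ σᶠ ĉ proper , λ w y e → from-recoloured w y e ext)
        where
        from-recoloured : ∀ w y → recolour σ d w ≡ just y → Extendsℕ G d (σᶜ ĉ) → toℕ (lookup ĉ w) ≡ y
        from-recoloured w y e ext with d w in dw
        from-recoloured w _ refl ext | just x = begin
          toℕ (lookup ĉ w)            ≡⟨ sym (σ-involutive _) ⟩
          σ (σ (toℕ (lookup ĉ w)))    ≡⟨ cong σ (trans (sym (toℕ-σᶜ ĉ w)) (ext w x dw)) ⟩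
          σ x                         ∎
          where open ≡-Reasoning

    #extensions-recolour : ∀ d → #extensions G (recolour σ d) m ≡ #extensions G d m
    #extensions-recolour d = begin
      sumOver cs (λ ĉ → indicator (properExtensionℕ? G (recolour σ d) m ĉ))
        ≡⟨ sumOver-cong (λ ĉ → indicator-⇔ (ProperExtension-recolour d ĉ)
                                           (properExtensionℕ? G (recolour σ d) m ĉ)
                                           (properExtensionℕ? G d m (σᶜ ĉ))) cs ⟩
      sumOver cs (λ ĉ → indicator (properExtensionℕ? G d m (σᶜ ĉ)))
        ≡⟨ sumOver-involution (colourings G m) σᶜ σᶜ-involutive (indicator ∘ properExtensionℕ? G d m) ⟩
      sumOver cs (λ ĉ → indicator (properExtensionℕ? G d m ĉ))   ∎
      where
      open ≡-Reasoning
      cs : List (Coloring n m)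
      cs = list (colourings G m)

module _ {n : ℕ} (G : Graph n) {d : Precoloring n} {v : Fin n} {k : ℕ} (bounded : Bounded d k) where

  #extensions-≔-above : ∀ {i m} → k ≤ i → i < m →
                        #extensions G (d [ v ≔ i ]) m ≡ #extensions G (d [ v ≔ k ]) m
  #extensions-≔-above {i} {m} k≤i i<m = begin
    #extensions G (d [ v ≔ i ]) m                         ≡⟨ #extensions-cong G m ≔i≗swapped ⟩
    #extensions G (recolour (swap i k) (d [ v ≔ k ])) m   ≡⟨ #extensions-recolour G (swap i k) (swap-involutive i k)
                                                                 (swap-< i<m k<m) (d [ v ≔ k ]) ⟩
    #extensions G (d [ v ≔ k ]) m                         ∎
    where
    open ≡-Reasoning
    k<m : k < m
    k<m = ℕ.≤-<-trans k≤i i<m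
    fixed : ∀ w x → d w ≡ just x → x ≡ swap i k x
    fixed w x dw = let x<k = bounded w x dw in
      sym (swap-fixes i k x (ℕ.<⇒≢ (ℕ.<-≤-trans x<k k≤i)) (ℕ.<⇒≢ x<k))
    ≔i≗swapped : ∀ w → (d [ v ≔ i ]) w ≡ recolour (swap i k) (d [ v ≔ k ]) w
    ≔i≗swapped = Insertion-unique (≔-Insertion d v i) (Insertion-recolour (swap i k) (≔-Insertion d v k))
                                  (sym (swap-right i k)) fixed

  -- d [ v ≔↑ j ] is obtained from d [ v ≔↑ (j + 1) ] by swapping the colours j and j + 1.
  #extensions-≔↑ : ∀ {j m} → j ≤ k → k < m →
                   #extensions G (d [ v ≔↑ j ]) m ≡ #extensions G (d [ v ≔ k ]) m
  #extensions-≔↑ {j} {m} j≤k k<m with ℕ.m≤n⇒∃[o]m+o≡n j≤k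
  ... | gap , j+gap≡k = go gap j j+gap≡k
    where
    at-k : #extensions G (d [ v ≔↑ k ]) m ≡ #extensions G (d [ v ≔ k ]) m
    at-k = #extensions-cong G m (Insertion-unique (recolour-≔-Insertion (shiftFrom k) d v k) (≔-Insertion d v k)
                                                  refl (λ w x dw → shiftFrom-< (bounded w x dw)))
    step : ∀ j → j < k → #extensions G (d [ v ≔↑ j ]) m ≡ #extensions G (d [ v ≔↑ suc j ]) m
    step j j<k = trans
      (#extensions-cong G m
        (Insertion-unique (recolour-≔-Insertion (shiftFrom j) d v j)
                          (Insertion-recolour (swap j (suc j)) (recolour-≔-Insertion (shiftFrom (suc j)) d v (suc j)))
                          (sym (swap-right j (suc j))) (λ _ x _ → shiftFrom-swap j x)))
      (#extensions-recolour G (swap j (suc j)) (swap-involutive j (suc j))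
                            (swap-< (ℕ.<-trans j<k k<m) (ℕ.≤-<-trans j<k k<m)) (d [ v ≔↑ suc j ]))
    go : ∀ gap j → j + gap ≡ k → #extensions G (d [ v ≔↑ j ]) m ≡ #extensions G (d [ v ≔ k ]) m
    go zero      j j+0≡k =
      trans (cong (λ j′ → #extensions G (d [ v ≔↑ j′ ]) m) (trans (sym (ℕ.+-identityʳ j)) j+0≡k)) at-k
    go (suc gap) j j+gap≡k = trans (step j (subst (j <_) j+gap≡k (ℕ.m<m+n j (s≤s z≤n))))
                                   (go gap (suc j) (trans (sym (ℕ.+-suc j gap)) j+gap≡k))

-- Fully coloured graphs

does-true : {A : Set} (a? : Dec A) → does a? ≡ true → A
does-true (yes a) _ = a

does-false : {A : Set} (a? : Dec A) → does a? ≡ false → ¬ A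
does-false (no ¬a) _ = ¬a

module FullyColoured {n} (G : Graph n) {d : Precoloring n} (κ : Fin n → ℕ) (d≡κ : ∀ w → d w ≡ just (κ w))
       where

  private
    κ≡ : ∀ {w x} → d w ≡ just x → κ w ≡ x
    κ≡ {w} dw≡x with trans (sym (d≡κ w)) dw≡x
    ... | refl = refl

  ProperColouring : Set
  ProperColouring = ∀ i → κ (src G i) ≢ κ (tgt G i)

  properColouring? : Dec ProperColouring
  properColouring? = Fin.all? λ i → ¬? (κ (src G i) ℕ.≟ κ (tgt G i))

  module _ {m} (bounded : Bounded d m) where

    private
      ĉ₀ : Coloring n m
      ĉ₀ = Vec.tabulate λ w → fromℕ< (bounded w (κ w) (d≡κ w))

      toℕ-ĉ₀ : ∀ w → toℕ (lookup ĉ₀ w) ≡ κ w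
      toℕ-ĉ₀ w = trans (cong toℕ (Vec.lookup∘tabulate _ w)) (Fin.toℕ-fromℕ< _)

      ĉ₀-same⇔ : ∀ u w → lookup ĉ₀ u ≡ lookup ĉ₀ w ⇔ κ u ≡ κ w
      ĉ₀-same⇔ u w = mk⇔ (λ eq → trans (sym (toℕ-ĉ₀ u)) (trans (cong toℕ eq) (toℕ-ĉ₀ w)))
                         (λ eq → Fin.toℕ-injective (trans (toℕ-ĉ₀ u) (trans eq (sym (toℕ-ĉ₀ w)))))

      Extends⇒≡ĉ₀ : ∀ {ĉ} → Extendsℕ G d ĉ → ĉ ≡ ĉ₀
      Extends⇒≡ĉ₀ ext = lookup-extensionality λ w →
        Fin.toℕ-injective (trans (ext w (κ w) (d≡κ w)) (sym (toℕ-ĉ₀ w)))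

      Proper-ĉ₀⇔ : Proper G ĉ₀ ⇔ ProperColouring
      Proper-ĉ₀⇔ = mk⇔ (λ proper i κ≡ → proper (src G i) (tgt G i) (i , refl) (from (ĉ₀-same⇔ _ _) κ≡))
                       (λ { proper u w (i , refl) same → proper i (to (ĉ₀-same⇔ u w) same) })

      ProperExtension⇔ĉ₀ : ∀ ĉ → ProperExtensionℕ G d m ĉ ⇔ (ProperColouring × ĉ ≡ ĉ₀)
      ProperExtension⇔ĉ₀ ĉ = mk⇔
        (λ (proper , ext) → let ĉ≡ĉ₀ = Extends⇒≡ĉ₀ {ĉ} ext in
                            to Proper-ĉ₀⇔ (subst (Proper G) ĉ≡ĉ₀ proper) , ĉ≡ĉ₀)
        (λ { (proper , refl) → from Proper-ĉ₀⇔ proper , λ w x dw≡x → trans (toℕ-ĉ₀ w) (κ≡ dw≡x) })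

    #extensions-fullyColoured : #extensions G d m ≡ indicator properColouring?
    #extensions-fullyColoured =
      sym (HasCount⇒≡count (colourings G m) (properExtensionℕ? G d m)
             (HasCount-singleton ĉ₀ ProperExtension⇔ĉ₀ properColouring?))

  private
    o* : Orientation G
    o* = Vec.tabulate λ i → does (κ (src G i) ℕ.<? κ (tgt G i))

    lookup-o* : ∀ i → lookup o* i ≡ does (κ (src G i) ℕ.<? κ (tgt G i))
    lookup-o* = Vec.lookup∘tabulate _

    arc-increasing : ProperColouring → ∀ {u w} → Arc G o* u w → κ u < κ w
    arc-increasing _      (i , inj₁ (refl , o*i≡true)) =
      does-true (κ (src G i) ℕ.<? κ (tgt G i)) (trans (sym (lookup-o* i)) o*i≡true)
    arc-increasing proper (i , inj₂ (refl , o*i≡false)) =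
      ℕ.≤∧≢⇒< (ℕ.≮⇒≥ (does-false (κ (src G i) ℕ.<? κ (tgt G i)) (trans (sym (lookup-o* i)) o*i≡false)))
              (proper i ∘ sym)

    path-increasing : ProperColouring → ∀ {u w} → Path G o* u w → κ u < κ w
    path-increasing proper (arc a)  = arc-increasing proper a
    path-increasing proper (a ∷ₚ p) = ℕ.<-trans (arc-increasing proper a) (path-increasing proper p)

    no-path-downwards : ∀ {o} → Good G d o → ∀ {a b} → κ b ≤ κ a → ¬ Path G o a b
    no-path-downwards (_ , compatible) {a} {b} = compatible a b (κ a) (κ b) (d≡κ a) (d≡κ b)

    orientation-forced : ∀ {o} → Good G d o → ∀ i → lookup o i ≡ lookup o* i
    orientation-forced {o} good i = trans (forced (κ (src G i) ℕ.<? κ (tgt G i))) (sym (lookup-o* i))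
      where
      forced : (s<t? : Dec (κ (src G i) < κ (tgt G i))) → lookup o i ≡ does s<t?
      forced s<t? with s<t? | lookup o i in oi
      ... | yes _   | true  = refl
      ... | yes s<t | false = ⊥-elim (no-path-downwards good (ℕ.<⇒≤ s<t) (arc (i , inj₂ (refl , oi))))
      ... | no  s≮t | true  = ⊥-elim (no-path-downwards good (ℕ.≮⇒≥ s≮t) (arc (i , inj₁ (refl , oi))))
      ... | no  _   | false = refl

    edges-properly-coloured : ∀ {o} → Good G d o → ProperColouring
    edges-properly-coloured {o} good i s≡t with lookup o i in oi
    ... | true  = no-path-downwards good (ℕ.≤-reflexive (sym s≡t)) (arc (i , inj₁ (refl , oi)))
    ... | false = no-path-downwards good (ℕ.≤-reflexive s≡t) (arc (i , inj₂ (refl , oi)))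

    Good⇔o* : ∀ o → Good G d o ⇔ (ProperColouring × o ≡ o*)
    Good⇔o* o = mk⇔
      (λ good → edges-properly-coloured good , lookup-extensionality (orientation-forced good))
      (λ { (proper , refl) →
         (λ v p → ℕ.<-irrefl refl (path-increasing proper p)) ,
         (λ a b x y da db y≤x p →
            ℕ.<⇒≱ (path-increasing proper p) (subst₂ _≤_ (sym (κ≡ db)) (sym (κ≡ da)) y≤x)) })

  #good-fullyColoured : #good G d ≡ indicator properColouring?
  #good-fullyColoured =
    sym (HasCount⇒≡count (orientations G) (good? G d) (HasCount-singleton o* Good⇔o* properColouring?))

-- Reciprocity

sign : ℕ → ℤ
sign u = -1ℤ ^ u

∣sign*∣ : ∀ u g → ∣ sign u *ℤ + g ∣ ≡ g
∣sign*∣ u g = trans (ℤ.abs-* (sign u) (+ g)) (trans (cong (ℕ._* g) (∣sign∣ u)) (ℕ.*-identityˡ g))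
  where
  ∣sign∣ : ∀ u → ∣ sign u ∣ ≡ 1
  ∣sign∣ zero    = refl
  ∣sign∣ (suc u) = trans (ℤ.abs-* -1ℤ (sign u)) (trans (ℕ.*-identityˡ _) (∣sign∣ u))

sign*-injective : ∀ u {a b} → sign u *ℤ + a ≡ sign u *ℤ + b → a ≡ b
sign*-injective u {a} {b} eq = trans (sym (∣sign*∣ u a)) (trans (cong ∣_∣ eq) (∣sign*∣ u b))

module _ {n : ℕ} (G : Graph n) where

  record Reciprocity (d : Precoloring n) (u : ℕ) : Set where
    field
      poly         : Poly
      chromatic    : ∀ m → Bounded d m → eval poly (+ m) ≡ + #extensions G d m
      at-minus-one : eval poly -1ℤ ≡ sign u *ℤ + #good G d

  open Reciprocity public

  #good-determined : ∀ {d₁ d₂ u t} → Reciprocity d₁ u → Reciprocity d₂ u →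
                     Bounded d₁ t → Bounded d₂ t → (∀ m → t ≤ m → #extensions G d₁ m ≡ #extensions G d₂ m) →
                     #good G d₁ ≡ #good G d₂
  #good-determined {u = u} {t} r₁ r₂ bounded₁ bounded₂ #ext≡ = sign*-injective u (begin
    sign u *ℤ + #good G _   ≡⟨ sym (at-minus-one r₁) ⟩
    eval (poly r₁) -1ℤ      ≡⟨ agreeAbove⇒agree t (poly r₁) (poly r₂) agree -1ℤ ⟩
    eval (poly r₂) -1ℤ      ≡⟨ at-minus-one r₂ ⟩
    sign u *ℤ + #good G _   ∎)
    where
    open ≡-Reasoning
    agree : ∀ m → t ≤ m → eval (poly r₁) (+ m) ≡ eval (poly r₂) (+ m)
    agree m t≤m = trans (chromatic r₁ m (Bounded-mono t≤m bounded₁))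
                        (trans (cong +_ (#ext≡ m t≤m)) (sym (chromatic r₂ m (Bounded-mono t≤m bounded₂))))

  module Step {d : Precoloring n} {v : Fin n} (dv≡nothing : d v ≡ nothing) {u : ℕ}
              (ih : ∀ {d′ c f} → Insertion d d′ v c f → Reciprocity d′ u) where

    private
      -- the least bound, so that k ≤ m whenever m bounds the colours of d
      k : ℕ
      k = colourBound d

      bounded : Bounded d k
      bounded = Bounded-colourBound d

      P≔ : ℕ → Poly
      P≔ i = poly (ih (≔-Insertion d v i))

      top : Precoloring n
      top = d [ v ≔ k ]

    P : Poly
    P = sumPoly k P≔ ⊕ mulXPlus (- + k) (P≔ k)

    eval-P : ∀ x → eval P x ≡ eval (sumPoly k P≔) x +ℤ (x +ℤ - + k) *ℤ eval (P≔ k) x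
    eval-P x = trans (eval-⊕ (sumPoly k P≔) _ x)
                     (cong (eval (sumPoly k P≔) x +ℤ_) (eval-mulXPlus (- + k) (P≔ k) x))

    #good-≔↑ : ∀ j → j ≤ k → #good G (d [ v ≔↑ j ]) ≡ #good G top
    #good-≔↑ j j≤k =
      #good-determined {u = u} (ih ins↑) (ih (≔-Insertion d v k))
        (Insertion-Bounded ins↑ (s≤s j≤k) (λ w x dw → s≤s (ℕ.≤-trans (shiftFrom-≤ j x) (bounded w x dw))))
        (Insertion-Bounded (≔-Insertion d v k) ℕ.≤-refl (λ w x dw → ℕ.m<n⇒m<1+n (bounded w x dw)))
        (λ m k<m → #extensions-≔↑ G bounded j≤k k<m)
      where
      ins↑ : Insertion d (d [ v ≔↑ j ]) v j (shiftFrom j)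
      ins↑ = recolour-≔-Insertion (shiftFrom j) d v j

    #good-recurrence-top : #good G d + sumBelow k (λ i → #good G (d [ v ≔ i ])) ≡ suc k * #good G top
    #good-recurrence-top = begin
      #good G d + sumBelow k (λ i → #good G (d [ v ≔ i ]))
        ≡⟨ #good-recurrence G d v dv≡nothing k bounded ⟩
      sumBelow (suc k) (λ j → #good G (d [ v ≔↑ j ]))
        ≡⟨ sumBelow-cong (suc k) (λ j j≤k → #good-≔↑ j (ℕ.≤-pred j≤k)) ⟩
      sumBelow (suc k) (λ _ → #good G top)
        ≡⟨ sumBelow-const (suc k) _ ⟩
      suc k * #good G top   ∎
      where open ≡-Reasoning

    P-counts-extensions : ∀ m → Bounded d m → eval P (+ m) ≡ + #extensions G d m
    P-counts-extensions m bounded-m = begin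
      eval P (+ m)
        ≡⟨ eval-P (+ m) ⟩
      eval (sumPoly k P≔) (+ m) +ℤ (+ m +ℤ - + k) *ℤ eval (P≔ k) (+ m)
        ≡⟨ cong₂ _+ℤ_ below-k above-k ⟩
      + 1 *ℤ + sumBelow k N +ℤ + ((m ∸ k) * N k)
        ≡⟨ cong (_+ℤ + ((m ∸ k) * N k)) (ℤ.*-identityˡ (+ sumBelow k N)) ⟩
      + sumBelow k N +ℤ + ((m ∸ k) * N k)
        ≡⟨ sym (ℤ.pos-+ (sumBelow k N) _) ⟩
      + (sumBelow k N + (m ∸ k) * N k)
        ≡⟨ cong +_ (sym (sumBelow-constFrom (N k) N k≤m λ _ → #extensions-≔-above G bounded)) ⟩
      + sumBelow m N
        ≡⟨ cong +_ (sym (#extensions-partition G m dv≡nothing)) ⟩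
      + #extensions G d m   ∎
      where
      open ≡-Reasoning
      k≤m : k ≤ m
      k≤m = colourBound-least d bounded-m
      N : ℕ → ℕ
      N i = #extensions G (d [ v ≔ i ]) m
      eval-P≔ : ∀ i → i < m → eval (P≔ i) (+ m) ≡ + N i
      eval-P≔ i i<m = chromatic (ih (≔-Insertion d v i)) m
                        (Insertion-Bounded (≔-Insertion d v i) i<m bounded-m)
      below-k : eval (sumPoly k P≔) (+ m) ≡ + 1 *ℤ + sumBelow k N
      below-k = eval-sumPoly k P≔ (+ m) (+ 1) N λ i i<k →
                  trans (eval-P≔ i (ℕ.<-≤-trans i<k k≤m)) (sym (ℤ.*-identityˡ _))
      above-k : (+ m +ℤ - + k) *ℤ eval (P≔ k) (+ m) ≡ + ((m ∸ k) * N k)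
      above-k rewrite ℤ.m-n≡m⊖n m k | ℤ.⊖-≥ k≤m with ℕ.m≤n⇒m<n∨m≡n k≤m
      ... | inj₁ k<m  = trans (cong (+ (m ∸ k) *ℤ_) (eval-P≔ k k<m)) (sym (ℤ.pos-* (m ∸ k) (N k)))
      ... | inj₂ refl rewrite ℕ.n∸n≡0 k = refl

    P-at-minus-one : eval P -1ℤ ≡ sign (suc u) *ℤ + #good G d
    P-at-minus-one = begin
      eval P -1ℤ
        ≡⟨ eval-P -1ℤ ⟩
      eval (sumPoly k P≔) -1ℤ +ℤ (-1ℤ +ℤ - + k) *ℤ eval (P≔ k) -1ℤ
        ≡⟨ cong₂ (λ a b → a +ℤ (-1ℤ +ℤ - + k) *ℤ b) below-k top-at-1 ⟩
      s *ℤ A +ℤ (-1ℤ +ℤ - + k) *ℤ (s *ℤ T)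
        ≡⟨ regroup s A T (+ k) ⟩
      s *ℤ A +ℤ - (s *ℤ ((+ 1 +ℤ + k) *ℤ T))
        ≡⟨ cong (λ t → s *ℤ A +ℤ - (s *ℤ t)) recurrence ⟩
      s *ℤ A +ℤ - (s *ℤ (g +ℤ A))
        ≡⟨ cancel s A g ⟩
      -1ℤ *ℤ s *ℤ g   ∎
      where
      open ≡-Reasoning
      s A T g : ℤ
      s = sign u
      A = + sumBelow k (λ i → #good G (d [ v ≔ i ]))
      T = + #good G top
      g = + #good G d
      below-k : eval (sumPoly k P≔) -1ℤ ≡ s *ℤ A
      below-k = eval-sumPoly k P≔ -1ℤ s _ λ i _ → at-minus-one (ih (≔-Insertion d v i))
      top-at-1 : eval (P≔ k) -1ℤ ≡ s *ℤ T
      top-at-1 = at-minus-one (ih (≔-Insertion d v k))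
      recurrence : (+ 1 +ℤ + k) *ℤ T ≡ g +ℤ A
      recurrence = begin
        (+ 1 +ℤ + k) *ℤ T                 ≡⟨ sym (ℤ.pos-* (suc k) (#good G top)) ⟩
        + (suc k * #good G top)           ≡⟨ cong +_ (sym #good-recurrence-top) ⟩
        + (#good G d + sumBelow k _)      ≡⟨ ℤ.pos-+ (#good G d) _ ⟩
        g +ℤ A                            ∎
      regroup : ∀ s A T k →
                s *ℤ A +ℤ (-1ℤ +ℤ - k) *ℤ (s *ℤ T) ≡ s *ℤ A +ℤ - (s *ℤ ((+ 1 +ℤ k) *ℤ T))
      regroup = solve-∀
      cancel : ∀ s A g → s *ℤ A +ℤ - (s *ℤ (g +ℤ A)) ≡ -1ℤ *ℤ s *ℤ g
      cancel = solve-∀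

    reciprocity-step : Reciprocity d (suc u)
    reciprocity-step = record { poly = P ; chromatic = P-counts-extensions ; at-minus-one = P-at-minus-one }

  reciprocity : ∀ S d → Uncoloured d S → Reciprocity d (length S)
  reciprocity [] d unc = record
    { poly         = const-poly
    ; chromatic    = λ m bounded →
        trans (eval-const-poly (+ m)) (cong +_ (sym (#extensions-fullyColoured bounded)))
    ; at-minus-one =
        trans (eval-const-poly -1ℤ) (trans (cong +_ (sym #good-fullyColoured)) (sym (ℤ.*-identityˡ _)))
    }
    where
    open Uncoloured unc
    colour : ∀ w → Σ ℕ λ x → d w ≡ just x
    colour w with d w in dw
    ... | just x  = x , refl
    ... | nothing with to (members w) dw
    ...   | ()
    open FullyColoured G (proj₁ ∘ colour) (proj₂ ∘ colour)
    const-poly : Poly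
    const-poly = + indicator properColouring? ∷ []
    eval-const-poly : ∀ x → eval const-poly x ≡ + indicator properColouring?
    eval-const-poly x = trans (cong (+ indicator properColouring? +ℤ_) (ℤ.*-zeroʳ x)) (ℤ.+-identityʳ _)
  reciprocity (v ∷ S) d unc = reciprocity-step
    where
    dv≡nothing : d v ≡ nothing
    dv≡nothing = from (Uncoloured.members unc v) (here refl)
    ih : ∀ {d′ c f} → Insertion d d′ v c f → Reciprocity d′ (length S)
    ih ins = reciprocity S _ (Insertion-Uncoloured ins unc)
    open Step dv≡nothing {length S} ih

module _ {n k : ℕ} (c : PartialColoring n k) where

  toPrecoloring : Precoloring n
  toPrecoloring w = Maybe.map toℕ (c w)

  private
    colour-of : ∀ {w x} → toPrecoloring w ≡ just x → Σ (Fin k) λ i → c w ≡ just i × toℕ i ≡ x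
    colour-of {w} e with c w
    colour-of refl | just i = i , refl , refl

  Bounded-toPrecoloring : ∀ {m} → k ≤ m → Bounded toPrecoloring m
  Bounded-toPrecoloring k≤m w x e with colour-of e
  ... | i , _ , refl = ℕ.<-≤-trans (Fin.toℕ<n i) k≤m

  module _ (G : Graph n) where

    ProperExtensionℕ⇔ProperExtension : ∀ m ĉ →
                                       ProperExtensionℕ G toPrecoloring m ĉ ⇔ ProperExtension G c m ĉ
    ProperExtensionℕ⇔ProperExtension m ĉ = mk⇔
      (λ (proper , ext) → proper , λ w i cw≡i → ext w (toℕ i) (cong (Maybe.map toℕ) cw≡i))
      (λ (proper , ext) → proper , λ w x e → let (i , cw≡i , i≡x) = colour-of e in trans (ext w i cw≡i) i≡x)

    Good⇔GoodOrientation : ∀ o → Good G toPrecoloring o ⇔ GoodOrientation G c o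
    Good⇔GoodOrientation o = mk⇔
      (λ (acyclic , compatible) → acyclic , λ a b i j ca cb j≤i →
         compatible a b (toℕ i) (toℕ j) (cong (Maybe.map toℕ) ca) (cong (Maybe.map toℕ) cb) j≤i)
      (λ (acyclic , compatible) → acyclic , λ a b x y da db y≤x →
         let (i , ca , i≡x) = colour-of da ; (j , cb , j≡y) = colour-of db in
         compatible a b i j ca cb (subst₂ _≤_ (sym j≡y) (sym i≡x) y≤x))

    ProperExtension-count : ∀ m → HasCount (ProperExtension G c m) (#extensions G toPrecoloring m)
    ProperExtension-count m = HasCount-⇔ (ProperExtensionℕ⇔ProperExtension m)
                                         (count-HasCount (colourings G m) (properExtensionℕ? G toPrecoloring m))

    GoodOrientation-count : HasCount (GoodOrientation G c) (#good G toPrecoloring)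
    GoodOrientation-count =
      HasCount-⇔ Good⇔GoodOrientation (count-HasCount (orientations G) (good? G toPrecoloring))

    IsChromaticPoly-unique : ∀ P₁ P₂ → IsChromaticPoly G c P₁ → IsChromaticPoly G c P₂ →
                             ∀ x → eval P₁ x ≡ eval P₂ x
    IsChromaticPoly-unique P₁ P₂ χ₁ χ₂ = agreeAbove⇒agree k P₁ P₂ agree
      where
      agree : ∀ m → k ≤ m → eval P₁ (+ m) ≡ eval P₂ (+ m)
      agree m k≤m with χ₁ m k≤m | χ₂ m k≤m
      ... | N₁ , count₁ , P₁m≡N₁ | N₂ , count₂ , P₂m≡N₂ =
        trans P₁m≡N₁ (trans (cong +_ (HasCount-unique count₁ count₂)) (sym P₂m≡N₂))

corollary4p4 : (n k : ℕ) (G : Graph n) (c : PartialColoring n k) →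
    Σ Poly (IsChromaticPoly G c) ×
    ((P : Poly) → IsChromaticPoly G c P →
      HasCount (GoodOrientation G c) ∣ eval P -[1+ 0 ] ∣)
corollary4p4 n k G c = (poly r , isChromatic) , λ P′ isChromatic′ →
  subst (HasCount (GoodOrientation G c)) (sym (∣P′[-1]∣≡#good P′ isChromatic′)) (GoodOrientation-count c G)
  where
  d : Precoloring n
  d = toPrecoloring c
  S : List (Fin n)
  S = proj₁ (uncoloured d)
  r : Reciprocity G d (length S)
  r = reciprocity G S d (proj₂ (uncoloured d))
  isChromatic : IsChromaticPoly G c (poly r)
  isChromatic m k≤m =
    #extensions G d m , ProperExtension-count c G m , chromatic r m (Bounded-toPrecoloring c k≤m)
  ∣P′[-1]∣≡#good : ∀ P′ → IsChromaticPoly G c P′ → ∣ eval P′ -[1+ 0 ] ∣ ≡ #good G d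
  ∣P′[-1]∣≡#good P′ isChromatic′ = begin
    ∣ eval P′ -[1+ 0 ] ∣
      ≡⟨ cong ∣_∣ (IsChromaticPoly-unique c G P′ (poly r) isChromatic′ isChromatic _) ⟩
    ∣ eval (poly r) -[1+ 0 ] ∣
      ≡⟨ cong ∣_∣ (at-minus-one r) ⟩
    ∣ sign (length S) *ℤ + #good G d ∣
      ≡⟨ ∣sign*∣ (length S) (#good G d) ⟩
    #good G d   ∎
    where open ≡-Reasoning
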